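{- Let $k\ge3$ be odd. The map $\delta\colon\mathrm{Pol}(\mathbf C_k,\mathbf C_3)\to\mathcal Z$ defined, for an $n$-ary polymorphism $f$, by $\delta(f)(x_1,\dots,x_n)=\deg_1f\cdot x_1+\dots+\deg_nf\cdot x_n$, is a minion homomorphism.
   Context: $\mathbf C_m$ is the $m$-cycle on $\{0,\dots,m-1\}$, vertices adjacent iff they differ by $1$ mod $m$. $\mathbf G^n$ is the direct power (vertex set $V(G)^n$, $(\bar u,\bar v)$ an edge iff $(u_j,v_j)\in E(G)$ for all $j$). $\mathrm{Pol}(\mathbf C_k,\mathbf C_3)$ is the set of all graph homomorphisms $\mathbf C_k^n\to\mathbf C_3$, $n\ge1$. $\Delta_{\mathsf E}(\mathbf G)$ is the free Abelian group generated by oriented edges $[u,v]$ of $\mathbf G$ with $[u,v]=-[v,u]$; sets of oriented edges are identified with their sums; a homomorphism $f$ induces $f_{\mathsf E}(\sum c_i[u_i,v_i])=\sum c_i[f(u_i),f(v_i)]$. $O_m=[0,1]+\dots+[m-1,0]\in\Delta_{\mathsf E}(\mathbf C_m)$. $O^n_{k,i}$ is the set of oriented edges $[(a_1,\dots,a_n),(b_1,\dots,b_n)]$ of $\mathbf C_k^n$ with $[a_i,b_i]\in O_k$. For an $n$-ary $f\in\mathrm{Pol}(\mathbf C_k,\mathbf C_3)$ and $i\le n$, $\deg_if$ is the (existing, unique) integer with $f_{\mathsf E}(O^n_{k,i})=(2k)^{n-1}\deg_if\cdot O_3$. $\mathcal Z$ is the minion of all functions $\mathbb Z^n\to\mathbb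 Z$ of the form $\sum_i c_ix_i$ with $c_i\in\mathbb Z$. A minor of an $m$-ary $g$ given by $\pi\colon\{1,\dots,m\}\to\{1,\dots,n\}$ is the $n$-ary function $(x_1,\dots,x_n)\mapsto g(x_{\pi(1)},\dots,x_{\pi(m)})$; a minion is a nonempty set of functions closed under minors; a minion homomorphism is a map preserving arities and sending the minor of $g$ given by $\pi$ to the minor of its image given by $\pi$, for every $g$ and $\pi$. -}

module Defs where

open import Data.Nat as ℕ using (ℕ; zero; suc; _∸_; _^_)
open import Data.Integer as ℤ using (ℤ; +_; -_; 0ℤ; 1ℤ)
open import Data.Fin using (Fin; zero; suc; toℕ)
open import Data.Fin.Properties using (all?) renaming (_≟_ to _≟F_)
open import Data.Nat.Properties using () renaming (_≟_ to _≟ℕ_)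
open import Data.List using (List; []; _∷_; map; concatMap; filter; foldr)
open import Data.Product using (Σ; _×_; _,_; proj₁; proj₂)
open import Data.Sum using (_⊎_; inj₁; inj₂)
open import Relation.Nullary using (Dec; yes; no; _×-dec_; _⊎-dec_)
open import Relation.Nullary.Decidable using (⌊_⌋)
open import Relation.Binary.PropositionalEquality using (_≡_)
open import Data.Bool using (if_then_else_)

Odd : ℕ → Set
Odd k = Σ ℕ λ t → k ≡ suc (2 ℕ.* t)

-- The cycle C_m on Fin m = {0,…,m-1}.
-- Next m a b  :  b = a + 1 (mod m), i.e. [a,b] is an oriented edge of O_m.

Next : (m : ℕ) → Fin m → Fin m → Set
Next m a b = (toℕ b ≡ suc (toℕ a)) ⊎ ((suc (toℕ a) ≡ m) × (toℕ b ≡ 0))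

next? : (m : ℕ) → (a b : Fin m) → Dec (Next m a b)
next? m a b = (toℕ b ≟ℕ suc (toℕ a)) ⊎-dec ((suc (toℕ a) ≟ℕ m) ×-dec (toℕ b ≟ℕ 0))

Adj : (m : ℕ) → Fin m → Fin m → Set
Adj m a b = Next m a b ⊎ Next m b a

adj? : (m : ℕ) → (a b : Fin m) → Dec (Adj m a b)
adj? m a b = next? m a b ⊎-dec next? m b a

Tuple : ℕ → ℕ → Set
Tuple k n = Fin n → Fin k

AdjPow : (k n : ℕ) → Tuple k n → Tuple k n → Set
AdjPow k n a b = ∀ j → Adj k (a j) (b j)

adjPow? : (k n : ℕ) → (a b : Tuple k n) → Dec (AdjPow k n a b)
adjPow? k n a b = all? (λ j → adj? k (a j) (b j))

cons : ∀ {k n} → Fin k → Tuple k n → Tuple k (suc n)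
cons x t zero    = x
cons x t (suc j) = t j

allFinL : (k : ℕ) → List (Fin k)
allFinL zero    = []
allFinL (suc k) = zero ∷ map suc (allFinL k)

allTuples : (k n : ℕ) → List (Tuple k n)
allTuples k zero    = (λ ()) ∷ []
allTuples k (suc n) = concatMap (λ x → map (cons x) (allTuples k n)) (allFinL k)

IsPol : (k n : ℕ) → (Tuple k n → Fin 3) → Set
IsPol k n f = ∀ a b → AdjPow k n a b → Adj 3 (f a) (f b)

minor : ∀ {A B : Set} {m n : ℕ} → ((Fin m → A) → B) → (Fin m → Fin n) → (Fin n → A) → B
minor g π x = g (λ i → x (π i))

-- Δ_E(G): free Abelian group on oriented edges [u,v] with [u,v] = -[v,u].
-- An element is represented by a finite formal integer combination
-- (list of (coefficient, u, v)).  Two formal sums denote the same element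
-- of Δ_E(G) iff their "antisymmetrised coefficients" agree on every
-- oriented edge:  coef s u v = (total coefficient of [u,v]) - (of [v,u]).

Chain : Set → Set
Chain V = List (ℤ × V × V)

coef : ∀ {m} → Chain (Fin m) → Fin m → Fin m → ℤ
coef [] u v = 0ℤ
coef ((c , x , y) ∷ s) u v =
  (if ⌊ (x ≟F u) ×-dec (y ≟F v) ⌋ then c else 0ℤ)
  ℤ.+ ((if ⌊ (x ≟F v) ×-dec (y ≟F u) ⌋ then ℤ.- c else 0ℤ)
  ℤ.+ coef s u v)

_≈E_ : ∀ {m} → Chain (Fin m) → Chain (Fin m) → Set
_≈E_ {m} s t = ∀ (u v : Fin m) → coef s u v ≡ coef t u v

setChain : ∀ {V : Set} → List (V × V) → Chain V
setChain = map (λ e → (1ℤ , proj₁ e , proj₂ e))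

_·E_ : ∀ {V : Set} → ℤ → Chain V → Chain V
z ·E s = map (λ t → (z ℤ.* proj₁ t , proj₂ t)) s

mapE : ∀ {V W : Set} → (V → W) → Chain V → Chain W
mapE f = map (λ t → (proj₁ t , f (proj₁ (proj₂ t)) , f (proj₂ (proj₂ t))))

O3 : Chain (Fin 3)
O3 = setChain ((zero , suc zero) ∷ (suc zero , suc (suc zero)) ∷ (suc (suc zero) , zero) ∷ [])

Oedges : (k n : ℕ) → Fin n → List (Tuple k n × Tuple k n)
Oedges k n i =
  filter (λ e → adjPow? k n (proj₁ e) (proj₂ e) ×-dec next? k (proj₁ e i) (proj₂ e i))
    (concatMap (λ a → map (λ b → (a , b)) (allTuples k n)) (allTuples k n))

O^ : (k n : ℕ) → Fin n → Chain (Tuple k n)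
O^ k n i = setChain (Oedges k n i)

IsDeg : (k n : ℕ) → (Tuple k n → Fin 3) → Fin n → ℤ → Set
IsDeg k n f i d = mapE f (O^ k n i) ≈E ((+ ((2 ℕ.* k) ^ (n ∸ 1)) ℤ.* d) ·E O3)

∑ : ∀ {n} → (Fin n → ℤ) → ℤ
∑ {zero}  x = 0ℤ
∑ {suc n} x = x zero ℤ.+ ∑ (λ j → x (suc j))

linear : ∀ {n} → (Fin n → ℤ) → (Fin n → ℤ) → ℤ
linear c x = ∑ (λ i → c i ℤ.* x i)

module Submission where

-- For a polymorphism h : C_kⁿ → C₃ and a sign vector ε, let Φ_h(ε) be the total winding
-- around C₃ of the images of the edges a → a ⊕ ε. Since h maps squares of C_kⁿ to squares
-- of C₃, Φ_h is affine in ε, and Φ_h(−ε) = −Φ_h(ε); hence 2Φ_h(ε) = Σᵢ εᵢ cᵢ with slopes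
-- cᵢ = Φ_h(↑…↑) − Φ_h(↑…↓…↑). Counting the edges of O^n_{k,i} gives cᵢ = 6 kⁿ⁻¹ degᵢ h.
-- For a minor g = h(x ∘ π), summing the winding over all translates u + {x ∘ π} of the
-- diagonal, which all carry the same winding because for odd k the steps a ↦ a ⊕ δ generate
-- every translation, gives kᵐ Φ_g(η) = kⁿ Φ_h(η ∘ π); comparing slopes yields
-- deg_j g = Σ_{π(i)=j} degᵢ h.
-- Degrees may be computed from any polymorphism q compatible with h (h x ~ q y along edges):
-- summing the square relation over the 2-paths x → y → z in direction i compares the two
-- windings. This lets h be replaced by h ∘ canon, which respects pointwise equality of tuples.

open import Defs
open import Data.Nat as ℕ using (ℕ; _≤_; zero; suc; z≤n; s≤s; _%_)
import Data.Nat.Properties as ℕP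
open import Data.Nat.DivMod
  using (_mod_; _/_; m≡m%n+[m/n]*n; m<n⇒m%n≡m; %-distribˡ-+; m%n%n≡m%n; [m+kn]%n≡m%n; n%n≡0)
import Data.Nat.Tactic.RingSolver as ℕ-Solver
open import Data.Integer using (ℤ; +_; -_; 0ℤ; 1ℤ; -1ℤ; _+_; _*_; _-_)
import Data.Integer.Properties as ℤP
open import Data.Integer.Tactic.RingSolver using (solve-∀)
open import Data.Fin using (Fin; zero; suc; toℕ)
open import Data.Fin.Properties using (all?; toℕ-injective; toℕ<n; toℕ-fromℕ<; suc-injective)
  renaming (_≟_ to _≟ᶠ_)
open import Data.Vec.Functional using (updateAt)
open import Data.Vec.Functional.Properties using (updateAt-updates; updateAt-minimal)
open import Data.List using (List; []; _∷_; [_]; _++_; map; concatMap; filter)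
open import Data.Bool using (true; false; if_then_else_)
open import Data.Product using (_×_; _,_; proj₁; proj₂)
open import Data.Sum using (_⊎_; inj₁; inj₂; [_,_]′)
open import Data.Empty using (⊥-elim)
open import Function using (_∘_; const)
open import Relation.Nullary using (¬_; Dec; yes; no; _×-dec_)
open import Relation.Nullary.Decidable using (⌊_⌋; toWitness; ¬?; _→-dec_)
open import Relation.Binary.PropositionalEquality
  using (_≡_; refl; sym; trans; cong; cong₂; subst; subst₂; _≢_; module ≡-Reasoning)
open ≡-Reasoning

private variable
  A B : Set

sumOver : List A → (A → ℤ) → ℤ
sumOver []       F = 0ℤ
sumOver (x ∷ xs) F = F x + sumOver xs F

syntax sumOver xs (λ x → e) = ∑[ x ∈ xs ] e

sum-cong : (xs : List A) {F G : A → ℤ} → (∀ x → F x ≡ G x) → sumOver xs F ≡ sumOver xs G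
sum-cong []       e = refl
sum-cong (x ∷ xs) e = cong₂ _+_ (e x) (sum-cong xs e)

sum-++ : (xs ys : List A) (F : A → ℤ) → sumOver (xs ++ ys) F ≡ sumOver xs F + sumOver ys F
sum-++ []       ys F = sym (ℤP.+-identityˡ _)
sum-++ (x ∷ xs) ys F = trans (cong (_+_ (F x)) (sum-++ xs ys F)) (sym (ℤP.+-assoc (F x) _ _))

sum-0 : (xs : List A) → ∑[ x ∈ xs ] 0ℤ ≡ 0ℤ
sum-0 []       = refl
sum-0 (x ∷ xs) = trans (ℤP.+-identityˡ _) (sum-0 xs)

sum-distrib-+ : (xs : List A) (F G : A → ℤ) →
                ∑[ x ∈ xs ] (F x + G x) ≡ sumOver xs F + sumOver xs G
sum-distrib-+ []       F G = refl
sum-distrib-+ (x ∷ xs) F G =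
  trans (cong (_+_ (F x + G x)) (sum-distrib-+ xs F G)) (swap (F x) (G x) _ _)
  where swap : ∀ a b c d → a + b + (c + d) ≡ a + c + (b + d)
        swap = solve-∀

sum-*ˡ : (xs : List A) (c : ℤ) (F : A → ℤ) → ∑[ x ∈ xs ] (c * F x) ≡ c * sumOver xs F
sum-*ˡ []       c F = sym (ℤP.*-zeroʳ c)
sum-*ˡ (x ∷ xs) c F =
  trans (cong (_+_ (c * F x)) (sum-*ˡ xs c F)) (sym (ℤP.*-distribˡ-+ c (F x) _))

sum-neg : (xs : List A) (F : A → ℤ) → ∑[ x ∈ xs ] (- F x) ≡ - sumOver xs F
sum-neg []       F = refl
sum-neg (x ∷ xs) F =
  trans (cong (_+_ (- F x)) (sum-neg xs F)) (sym (ℤP.neg-distrib-+ (F x) _))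

sum-comm : (xs : List A) (ys : List B) (F : A → B → ℤ) →
           ∑[ x ∈ xs ] ∑[ y ∈ ys ] F x y ≡ ∑[ y ∈ ys ] ∑[ x ∈ xs ] F x y
sum-comm []       ys F = sym (sum-0 ys)
sum-comm (x ∷ xs) ys F =
  trans (cong (_+_ (sumOver ys (F x))) (sum-comm xs ys F)) (sym (sum-distrib-+ ys (F x) _))

sum-map : (g : B → A) (xs : List B) (F : A → ℤ) → sumOver (map g xs) F ≡ ∑[ x ∈ xs ] F (g x)
sum-map g []       F = refl
sum-map g (x ∷ xs) F = cong (_+_ (F (g x))) (sum-map g xs F)

sum-concatMap : (g : B → List A) (xs : List B) (F : A → ℤ) →
                sumOver (concatMap g xs) F ≡ ∑[ x ∈ xs ] sumOver (g x) F
sum-concatMap g []       F = refl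
sum-concatMap g (x ∷ xs) F =
  trans (sum-++ (g x) (concatMap g xs) F) (cong (_+_ (sumOver (g x) F)) (sum-concatMap g xs F))

χ : {P : Set} → Dec P → ℤ
χ (yes _) = 1ℤ
χ (no _)  = 0ℤ

χ-cong : {P Q : Set} → (P → Q) → (Q → P) → (p : Dec P) (q : Dec Q) → χ p ≡ χ q
χ-cong f g (yes p) (yes q) = refl
χ-cong f g (yes p) (no ¬q) = ⊥-elim (¬q (f p))
χ-cong f g (no ¬p) (yes q) = ⊥-elim (¬p (g q))
χ-cong f g (no ¬p) (no ¬q) = refl

χ-× : {P Q : Set} (p : Dec P) (q : Dec Q) → χ (p ×-dec q) ≡ χ p * χ q
χ-× (yes p) (yes q) = refl
χ-× (yes p) (no q)  = refl
χ-× (no p)  (yes q) = refl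
χ-× (no p)  (no q)  = refl

χ-yes : {P : Set} (p : Dec P) → P → χ p ≡ 1ℤ
χ-yes (yes _) _ = refl
χ-yes (no ¬p) x = ⊥-elim (¬p x)

χ-no : {P : Set} (p : Dec P) → ¬ P → χ p ≡ 0ℤ
χ-no (yes x) ¬p = ⊥-elim (¬p x)
χ-no (no _)  _  = refl

χ-*-cong : {P : Set} (p : Dec P) {a b : ℤ} → (P → a ≡ b) → χ p * a ≡ χ p * b
χ-*-cong (yes x) e = cong (1ℤ *_) (e x)
χ-*-cong (no _)  e = refl

sum-filter : {P : A → Set} (P? : (x : A) → Dec (P x)) (xs : List A) (F : A → ℤ) →
             sumOver (filter P? xs) F ≡ ∑[ x ∈ xs ] (χ (P? x) * F x)
sum-filter P? []       F = refl
sum-filter P? (x ∷ xs) F with P? x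
... | yes _ = cong₂ _+_ (sym (ℤP.*-identityˡ (F x))) (sum-filter P? xs F)
... | no _  = trans (sum-filter P? xs F) (sym (ℤP.+-identityˡ _))

χ-all? : ∀ {n} {P : Fin (suc n) → Set} (P? : ∀ j → Dec (P j)) →
         χ (all? P?) ≡ χ (P? zero) * χ (all? (λ j → P? (suc j)))
χ-all? P? = trans (χ-cong (λ p → p zero , (λ j → p (suc j)))
                          (λ { (p₀ , p′) zero → p₀ ; (p₀ , p′) (suc j) → p′ j })
                          (all? P?) (P? zero ×-dec all? (λ j → P? (suc j))))
                  (χ-× (P? zero) _)

sum-allFin-suc : ∀ k (H : Fin (suc k) → ℤ) →
                 sumOver (allFinL (suc k)) H ≡ H zero + ∑[ y ∈ allFinL k ] H (suc y)
sum-allFin-suc k H = cong (_+_ (H zero)) (sum-map suc (allFinL k) H)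

sum-allFin-const : ∀ k c → ∑[ _ ∈ allFinL k ] c ≡ + k * c
sum-allFin-const zero    c = sym (ℤP.*-zeroˡ c)
sum-allFin-const (suc k) c = begin
  c + ∑[ _ ∈ map suc (allFinL k) ] c  ≡⟨ cong (_+_ c) (trans (sum-map suc (allFinL k) _) (sum-allFin-const k c)) ⟩
  c + + k * c                          ≡⟨ ring c (+ k) ⟩
  (1ℤ + + k) * c                       ∎
  where ring : ∀ c x → c + x * c ≡ (1ℤ + x) * c
        ring = solve-∀

sum-allFin-δ : ∀ k (u : Fin k) (H : Fin k → ℤ) → ∑[ y ∈ allFinL k ] (χ (y ≟ᶠ u) * H y) ≡ H u
sum-allFin-δ (suc k) zero H = begin
  ∑[ y ∈ allFinL (suc k) ] (χ (y ≟ᶠ zero) * H y)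
    ≡⟨ cong₂ _+_ (ℤP.*-identityˡ (H zero)) (sum-map suc (allFinL k) _) ⟩
  H zero + ∑[ y ∈ allFinL k ] (0ℤ * H (suc y))
    ≡⟨ cong (_+_ (H zero)) (sum-0 (allFinL k)) ⟩
  H zero + 0ℤ
    ≡⟨ ℤP.+-identityʳ _ ⟩
  H zero ∎
sum-allFin-δ (suc k) (suc u) H = begin
  ∑[ y ∈ allFinL (suc k) ] (χ (y ≟ᶠ suc u) * H y)        ≡⟨ sum-allFin-suc k (λ y → χ (y ≟ᶠ suc u) * H y) ⟩
  0ℤ + ∑[ y ∈ allFinL k ] (χ (suc y ≟ᶠ suc u) * H (suc y)) ≡⟨ ℤP.+-identityˡ _ ⟩
  ∑[ y ∈ allFinL k ] (χ (suc y ≟ᶠ suc u) * H (suc y))      ≡⟨ sum-cong (allFinL k) χ-suc ⟩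
  ∑[ y ∈ allFinL k ] (χ (y ≟ᶠ u) * H (suc y))              ≡⟨ sum-allFin-δ k u (λ y → H (suc y)) ⟩
  H (suc u)                                               ∎
  where χ-suc : ∀ y → χ (suc y ≟ᶠ suc u) * H (suc y) ≡ χ (y ≟ᶠ u) * H (suc y)
        χ-suc y = cong (_* H (suc y)) (χ-cong suc-injective (cong suc) (suc y ≟ᶠ suc u) (y ≟ᶠ u))

∑≡sum-allFin : ∀ {n} (x : Fin n → ℤ) → ∑ x ≡ sumOver (allFinL n) x
∑≡sum-allFin {zero}  x = refl
∑≡sum-allFin {suc n} x =
  trans (cong (_+_ (x zero)) (∑≡sum-allFin (λ j → x (suc j)))) (sym (sum-allFin-suc n x))

linear-cong : ∀ {n} {c c′ : Fin n → ℤ} → (∀ j → c j ≡ c′ j) → ∀ x → linear c x ≡ linear c′ x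
linear-cong {n} {c} {c′} c≗c′ x = begin
  linear c x                           ≡⟨ ∑≡sum-allFin (λ j → c j * x j) ⟩
  ∑[ j ∈ allFinL n ] (c j * x j)       ≡⟨ sum-cong (allFinL n) (λ j → cong (_* x j) (c≗c′ j)) ⟩
  ∑[ j ∈ allFinL n ] (c′ j * x j)      ≡⟨ ∑≡sum-allFin (λ j → c′ j * x j) ⟨
  linear c′ x                          ∎

linear-fibres : ∀ {m n} (π : Fin m → Fin n) (d : Fin m → ℤ) x →
  linear (λ j → ∑[ l ∈ allFinL m ] (χ (π l ≟ᶠ j) * d l)) x ≡ minor (linear d) π x
linear-fibres {m} {n} π d x = begin
  linear (λ j → ∑[ l ∈ allFinL m ] (χ (π l ≟ᶠ j) * d l)) x
    ≡⟨ ∑≡sum-allFin (λ j → ∑[ l ∈ allFinL m ] (χ (π l ≟ᶠ j) * d l) * x j) ⟩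
  ∑[ j ∈ allFinL n ] (∑[ l ∈ allFinL m ] (χ (π l ≟ᶠ j) * d l) * x j)
    ≡⟨ sum-cong (allFinL n) (λ j → trans (ℤP.*-comm (∑[ l ∈ allFinL m ] (χ (π l ≟ᶠ j) * d l)) (x j))
                                           (sym (sum-*ˡ (allFinL m) (x j) (λ l → χ (π l ≟ᶠ j) * d l)))) ⟩
  ∑[ j ∈ allFinL n ] ∑[ l ∈ allFinL m ] (x j * (χ (π l ≟ᶠ j) * d l))
    ≡⟨ sum-comm (allFinL n) (allFinL m) _ ⟩
  ∑[ l ∈ allFinL m ] ∑[ j ∈ allFinL n ] (x j * (χ (π l ≟ᶠ j) * d l))
    ≡⟨ sum-cong (allFinL m) (λ l → sum-cong (allFinL n) (λ j → reorder (x j) (χ (π l ≟ᶠ j)) (d l))) ⟩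
  ∑[ l ∈ allFinL m ] ∑[ j ∈ allFinL n ] (d l * (χ (π l ≟ᶠ j) * x j))
    ≡⟨ sum-cong (allFinL m) (λ l → trans (sum-*ˡ (allFinL n) (d l) _) (cong (d l *_) (begin
         ∑[ j ∈ allFinL n ] (χ (π l ≟ᶠ j) * x j)
           ≡⟨ sum-cong (allFinL n) (λ j → cong (_* x j) (χ-cong sym sym (π l ≟ᶠ j) (j ≟ᶠ π l))) ⟩
         ∑[ j ∈ allFinL n ] (χ (j ≟ᶠ π l) * x j)
           ≡⟨ sum-allFin-δ n (π l) x ⟩
         x (π l) ∎))) ⟩
  ∑[ l ∈ allFinL m ] (d l * x (π l))
    ≡⟨ ∑≡sum-allFin (λ l → d l * x (π l)) ⟨
  minor (linear d) π x ∎
  where reorder : ∀ a b c → a * (b * c) ≡ c * (b * a)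
        reorder = solve-∀

Extensional : ∀ {k m} → (Tuple k m → A) → Set
Extensional {k = k} {m} F = ∀ {a b : Tuple k m} → (∀ j → a j ≡ b j) → F a ≡ F b

_≐?_ : ∀ {k m} (a b : Tuple k m) → Dec (∀ j → a j ≡ b j)
a ≐? b = all? (λ j → a j ≟ᶠ b j)

cons-η : ∀ {k m} (a : Tuple k (suc m)) j → cons (a zero) (λ i → a (suc i)) j ≡ a j
cons-η a zero    = refl
cons-η a (suc j) = refl

-- Without function extensionality a function of tuples need not respect pointwise equality;
-- precomposing with canon makes it do so.
canon : ∀ {k m} → Tuple k m → Tuple k m
canon {m = zero}  a = λ ()
canon {m = suc m} a = cons (a zero) (canon (λ j → a (suc j)))

canon-pointwise : ∀ {k m} (a : Tuple k m) j → canon a j ≡ a j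
canon-pointwise {m = suc m} a zero    = refl
canon-pointwise {m = suc m} a (suc j) = canon-pointwise (λ j → a (suc j)) j

canon-cong : ∀ {k m} {a b : Tuple k m} → (∀ j → a j ≡ b j) → canon a ≡ canon b
canon-cong {m = zero}  a≐b = refl
canon-cong {m = suc m} a≐b = cong₂ cons (a≐b zero) (canon-cong (λ j → a≐b (suc j)))

sum-allTuples-suc : ∀ k m (F : Tuple k (suc m) → ℤ) →
  sumOver (allTuples k (suc m)) F ≡ ∑[ x ∈ allFinL k ] ∑[ t ∈ allTuples k m ] F (cons x t)
sum-allTuples-suc k m F =
  trans (sum-concatMap (λ x → map (cons x) (allTuples k m)) (allFinL k) F)
        (sum-cong (allFinL k) (λ x → sum-map (cons x) (allTuples k m) F))

sum-allTuples-const : ∀ k m c → ∑[ _ ∈ allTuples k m ] c ≡ + (k ℕ.^ m) * c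
sum-allTuples-const k zero    c = trans (ℤP.+-identityʳ c) (sym (ℤP.*-identityˡ c))
sum-allTuples-const k (suc m) c = begin
  ∑[ _ ∈ allTuples k (suc m) ] c                ≡⟨ sum-allTuples-suc k m _ ⟩
  ∑[ _ ∈ allFinL k ] ∑[ _ ∈ allTuples k m ] c   ≡⟨ sum-cong (allFinL k) (λ _ → sum-allTuples-const k m c) ⟩
  ∑[ _ ∈ allFinL k ] (+ (k ℕ.^ m) * c)          ≡⟨ sum-allFin-const k _ ⟩
  + k * (+ (k ℕ.^ m) * c)                       ≡⟨ ℤP.*-assoc (+ k) _ c ⟨
  + k * + (k ℕ.^ m) * c                         ≡⟨ cong (_* c) (ℤP.pos-* k (k ℕ.^ m)) ⟨
  + (k ℕ.^ suc m) * c                           ∎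

sum-allTuples-δ : ∀ k m (c : Tuple k m) (F : Tuple k m → ℤ) → Extensional F →
                  ∑[ b ∈ allTuples k m ] (χ (b ≐? c) * F b) ≡ F c
sum-allTuples-δ k zero c F ext = begin
  χ ((λ ()) ≐? c) * F (λ ()) + 0ℤ   ≡⟨ ℤP.+-identityʳ _ ⟩
  χ ((λ ()) ≐? c) * F (λ ())        ≡⟨ cong₂ _*_ (χ-yes ((λ ()) ≐? c) (λ ())) (ext (λ ())) ⟩
  1ℤ * F c                          ≡⟨ ℤP.*-identityˡ _ ⟩
  F c                               ∎
sum-allTuples-δ k (suc m) c F ext = begin
  ∑[ b ∈ allTuples k (suc m) ] (χ (b ≐? c) * F b)
    ≡⟨ sum-allTuples-suc k m _ ⟩
  ∑[ x ∈ allFinL k ] ∑[ t ∈ allTuples k m ] (χ (cons x t ≐? c) * F (cons x t))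
    ≡⟨ sum-cong (allFinL k) (λ x → sum-cong (allTuples k m) (split x)) ⟩
  ∑[ x ∈ allFinL k ] ∑[ t ∈ allTuples k m ] (χ (x ≟ᶠ c zero) * (χ (t ≐? c′) * F (cons x t)))
    ≡⟨ sum-cong (allFinL k) (λ x → sum-*ˡ (allTuples k m) (χ (x ≟ᶠ c zero)) _) ⟩
  ∑[ x ∈ allFinL k ] (χ (x ≟ᶠ c zero) * ∑[ t ∈ allTuples k m ] (χ (t ≐? c′) * F (cons x t)))
    ≡⟨ sum-cong (allFinL k) (λ x → cong (χ (x ≟ᶠ c zero) *_)
         (sum-allTuples-δ k m c′ (λ t → F (cons x t)) (λ e → ext (λ { zero → refl ; (suc j) → e j })))) ⟩
  ∑[ x ∈ allFinL k ] (χ (x ≟ᶠ c zero) * F (cons x c′))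
    ≡⟨ sum-allFin-δ k (c zero) _ ⟩
  F (cons (c zero) c′)
    ≡⟨ ext (cons-η c) ⟩
  F c ∎
  where
  c′ : Tuple k m
  c′ j = c (suc j)
  split : ∀ x t → χ (cons x t ≐? c) * F (cons x t) ≡ χ (x ≟ᶠ c zero) * (χ (t ≐? c′) * F (cons x t))
  split x t = trans (cong (_* F (cons x t)) (χ-all? (λ j → cons x t j ≟ᶠ c j)))
                    (ℤP.*-assoc (χ (x ≟ᶠ c zero)) _ _)

sum-allTuples-bijection : ∀ k m (τ ρ : Fin m → Fin k → Fin k) →
  (∀ j x → ρ j (τ j x) ≡ x) → (∀ j y → τ j (ρ j y) ≡ y) →
  (F : Tuple k m → ℤ) → Extensional F →
  ∑[ a ∈ allTuples k m ] F (λ j → τ j (a j)) ≡ sumOver (allTuples k m) F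
sum-allTuples-bijection k m τ ρ ρτ τρ F ext = begin
  ∑[ a ∈ allTuples k m ] F (τ* a)
    ≡⟨ sum-cong (allTuples k m) (λ a → sym (sum-allTuples-δ k m (τ* a) F ext)) ⟩
  ∑[ a ∈ allTuples k m ] ∑[ b ∈ allTuples k m ] (χ (b ≐? τ* a) * F b)
    ≡⟨ sum-comm (allTuples k m) (allTuples k m) _ ⟩
  ∑[ b ∈ allTuples k m ] ∑[ a ∈ allTuples k m ] (χ (b ≐? τ* a) * F b)
    ≡⟨ sum-cong (allTuples k m) (λ b → sum-cong (allTuples k m) (λ a →
         cong (_* F b) (χ-cong (λ e j → trans (sym (ρτ j (a j))) (cong (ρ j) (sym (e j))))
                               (λ e j → trans (sym (τρ j (b j))) (cong (τ j) (sym (e j))))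
                               (b ≐? τ* a) (a ≐? ρ* b)))) ⟩
  ∑[ b ∈ allTuples k m ] ∑[ a ∈ allTuples k m ] (χ (a ≐? ρ* b) * F b)
    ≡⟨ sum-cong (allTuples k m) (λ b → sum-allTuples-δ k m (ρ* b) (λ _ → F b) (λ _ → refl)) ⟩
  sumOver (allTuples k m) F ∎
  where
  τ* ρ* : Tuple k m → Tuple k m
  τ* a j = τ j (a j)
  ρ* b j = ρ j (b j)

coordinatewise⇒constant : ∀ {k} m (Ψ : Tuple k m → ℤ) → Extensional Ψ →
  (∀ l u z → Ψ (updateAt u l (const z)) ≡ Ψ u) → ∀ (z₀ : Fin k) u → Ψ u ≡ Ψ (const z₀)
coordinatewise⇒constant zero    Ψ ext change z₀ u = ext (λ ())
coordinatewise⇒constant (suc m) Ψ ext change z₀ u = begin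
  Ψ u                             ≡⟨ change zero u z₀ ⟨
  Ψ (updateAt u zero (const z₀))  ≡⟨ ext (λ { zero → refl ; (suc j) → refl }) ⟩
  Ψ′ u′                           ≡⟨ coordinatewise⇒constant m Ψ′ ext′ change′ z₀ u′ ⟩
  Ψ′ (const z₀)                   ≡⟨ ext (λ { zero → refl ; (suc j) → refl }) ⟩
  Ψ (const z₀)                    ∎
  where
  u′ : Tuple _ m
  u′ j = u (suc j)
  Ψ′ : Tuple _ m → ℤ
  Ψ′ t = Ψ (cons z₀ t)
  ext′ : Extensional Ψ′
  ext′ e = ext (λ { zero → refl ; (suc j) → e j })
  change′ : ∀ l t z → Ψ′ (updateAt t l (const z)) ≡ Ψ′ t
  change′ l t z = trans (ext (λ { zero → refl ; (suc j) → refl })) (change (suc l) (cons z₀ t) z)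

module Cycle (K : ℕ) where

  k : ℕ
  k = suc K

  shift : ℕ → Fin k → Fin k
  shift r x = (toℕ x ℕ.+ r) mod k

  up down : Fin k → Fin k
  up   = shift 1
  down = shift K

  toℕ-shift : ∀ r x → toℕ (shift r x) ≡ (toℕ x ℕ.+ r) % k
  toℕ-shift r x = toℕ-fromℕ< _

  %-absorbˡ : ∀ a b → (a % k ℕ.+ b) % k ≡ (a ℕ.+ b) % k
  %-absorbˡ a b = begin
    (a % k ℕ.+ b) % k            ≡⟨ %-distribˡ-+ (a % k) b k ⟩
    (a % k % k ℕ.+ b % k) % k    ≡⟨ cong (λ z → (z ℕ.+ b % k) % k) (m%n%n≡m%n a k) ⟩
    (a % k ℕ.+ b % k) % k        ≡⟨ %-distribˡ-+ a b k ⟨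
    (a ℕ.+ b) % k                ∎

  %-absorbʳ : ∀ a b → (a ℕ.+ b % k) % k ≡ (a ℕ.+ b) % k
  %-absorbʳ a b = begin
    (a ℕ.+ b % k) % k  ≡⟨ cong (_% k) (ℕP.+-comm a (b % k)) ⟩
    (b % k ℕ.+ a) % k  ≡⟨ %-absorbˡ b a ⟩
    (b ℕ.+ a) % k      ≡⟨ cong (_% k) (ℕP.+-comm b a) ⟩
    (a ℕ.+ b) % k      ∎

  shift-shift : ∀ r s x → shift r (shift s x) ≡ shift (s ℕ.+ r) x
  shift-shift r s x = toℕ-injective (begin
    toℕ (shift r (shift s x))        ≡⟨ toℕ-shift r (shift s x) ⟩
    (toℕ (shift s x) ℕ.+ r) % k      ≡⟨ cong (λ z → (z ℕ.+ r) % k) (toℕ-shift s x) ⟩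
    ((toℕ x ℕ.+ s) % k ℕ.+ r) % k    ≡⟨ %-absorbˡ (toℕ x ℕ.+ s) r ⟩
    (toℕ x ℕ.+ s ℕ.+ r) % k          ≡⟨ cong (_% k) (ℕP.+-assoc (toℕ x) s r) ⟩
    (toℕ x ℕ.+ (s ℕ.+ r)) % k        ≡⟨ toℕ-shift (s ℕ.+ r) x ⟨
    toℕ (shift (s ℕ.+ r) x)          ∎)

  shift-comm : ∀ r s x → shift r (shift s x) ≡ shift s (shift r x)
  shift-comm r s x = trans (shift-shift r s x)
                           (trans (cong (λ q → shift q x) (ℕP.+-comm s r)) (sym (shift-shift s r x)))

  shift-multiple : ∀ c x → shift (c ℕ.* k) x ≡ x
  shift-multiple c x = toℕ-injective (begin
    toℕ (shift (c ℕ.* k) x)      ≡⟨ toℕ-shift (c ℕ.* k) x ⟩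
    (toℕ x ℕ.+ c ℕ.* k) % k      ≡⟨ [m+kn]%n≡m%n (toℕ x) c k ⟩
    toℕ x % k                    ≡⟨ m<n⇒m%n≡m (toℕ<n x) ⟩
    toℕ x                        ∎)

  shift-0 : ∀ x → shift 0 x ≡ x
  shift-0 = shift-multiple 0

  shift-k : ∀ x → shift k x ≡ x
  shift-k x = trans (cong (λ q → shift q x) (sym (ℕP.*-identityˡ k))) (shift-multiple 1 x)

  shift-inverseˡ : ∀ r x → shift (r ℕ.* K) (shift r x) ≡ x
  shift-inverseˡ r x = begin
    shift (r ℕ.* K) (shift r x)   ≡⟨ shift-shift (r ℕ.* K) r x ⟩
    shift (r ℕ.+ r ℕ.* K) x       ≡⟨ cong (λ q → shift q x) (ℕP.*-suc r K) ⟨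
    shift (r ℕ.* k) x             ≡⟨ shift-multiple r x ⟩
    x                             ∎

  shift-inverseʳ : ∀ r x → shift r (shift (r ℕ.* K) x) ≡ x
  shift-inverseʳ r x = trans (shift-comm r (r ℕ.* K) x) (shift-inverseˡ r x)

  shift-toℕ : ∀ y → shift (toℕ y) zero ≡ y
  shift-toℕ y = toℕ-injective (trans (toℕ-shift (toℕ y) zero) (m<n⇒m%n≡m (toℕ<n y)))

  shift-toℕ-shift : ∀ r y z → shift (toℕ (shift r y)) z ≡ shift r (shift (toℕ y) z)
  shift-toℕ-shift r y z = toℕ-injective (begin
    toℕ (shift (toℕ (shift r y)) z)        ≡⟨ toℕ-shift _ z ⟩
    (toℕ z ℕ.+ toℕ (shift r y)) % k        ≡⟨ cong (λ q → (toℕ z ℕ.+ q) % k) (toℕ-shift r y) ⟩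
    (toℕ z ℕ.+ (toℕ y ℕ.+ r) % k) % k      ≡⟨ %-absorbʳ (toℕ z) (toℕ y ℕ.+ r) ⟩
    (toℕ z ℕ.+ (toℕ y ℕ.+ r)) % k          ≡⟨ cong (_% k) (ℕP.+-assoc (toℕ z) (toℕ y) r) ⟨
    (toℕ z ℕ.+ toℕ y ℕ.+ r) % k            ≡⟨ %-absorbˡ (toℕ z ℕ.+ toℕ y) r ⟨
    ((toℕ z ℕ.+ toℕ y) % k ℕ.+ r) % k      ≡⟨ cong (λ q → (q ℕ.+ r) % k) (toℕ-shift (toℕ y) z) ⟨
    (toℕ (shift (toℕ y) z) ℕ.+ r) % k      ≡⟨ toℕ-shift r (shift (toℕ y) z) ⟨
    toℕ (shift r (shift (toℕ y) z))        ∎)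

  down-up : ∀ x → down (up x) ≡ x
  down-up x = trans (shift-shift K 1 x) (shift-k x)

  up-down : ∀ x → up (down x) ≡ x
  up-down x = trans (shift-comm 1 K x) (down-up x)

  toℕ-up : ∀ x → toℕ (up x) ≡ suc (toℕ x) % k
  toℕ-up x = trans (toℕ-shift 1 x) (cong (_% k) (ℕP.+-comm (toℕ x) 1))

  next-up : ∀ x → Next k x (up x)
  next-up x with suc (toℕ x) ℕP.<? k
  ... | yes x+1<k = inj₁ (trans (toℕ-up x) (m<n⇒m%n≡m x+1<k))
  ... | no  x+1≮k = inj₂ (x+1≡k , trans (toℕ-up x) (trans (cong (_% k) x+1≡k) (n%n≡0 k)))
    where x+1≡k : suc (toℕ x) ≡ k
          x+1≡k = ℕP.≤-antisym (toℕ<n x) (ℕP.≮⇒≥ x+1≮k)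

  next⇒up : ∀ {x y} → Next k x y → y ≡ up x
  next⇒up {x} {y} (inj₁ y≡x+1) = toℕ-injective (trans y≡x+1 (sym (trans (toℕ-up x)
    (m<n⇒m%n≡m (subst (ℕ._< k) y≡x+1 (toℕ<n y))))))
  next⇒up {x} {y} (inj₂ (x+1≡k , y≡0)) = toℕ-injective (trans y≡0 (sym (trans (toℕ-up x)
    (trans (cong (_% k) x+1≡k) (n%n≡0 k)))))

  next-down : ∀ x → Next k (down x) x
  next-down x = subst (Next k (down x)) (up-down x) (next-up (down x))

  next⇒down : ∀ {x y} → Next k y x → y ≡ down x
  next⇒down {x} {y} n = trans (sym (down-up y)) (cong down (sym (next⇒up n)))

  -- up (up x) ≡ x would make 2 a multiple of k.
  up≢down : 2 ℕ.≤ K → ∀ x → up x ≢ down x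
  up≢down 2≤K x up≡down = 2≢multiple (x+2 / k) (ℕP.+-cancelˡ-≡ (toℕ x) 2 _ x+2≡x+q*k)
    where
    x+2 : ℕ
    x+2 = toℕ x ℕ.+ 2
    up²≡id : shift 2 x ≡ x
    up²≡id = begin
      shift 2 x    ≡⟨ shift-shift 1 1 x ⟨
      up (up x)    ≡⟨ cong up up≡down ⟩
      up (down x)  ≡⟨ up-down x ⟩
      x            ∎
    x+2≡x+q*k : x+2 ≡ toℕ x ℕ.+ x+2 / k ℕ.* k
    x+2≡x+q*k = trans (m≡m%n+[m/n]*n x+2 k)
                      (cong (ℕ._+ x+2 / k ℕ.* k) (trans (sym (toℕ-shift 2 x)) (cong toℕ up²≡id)))
    2≢multiple : ∀ q → 2 ≢ q ℕ.* k
    2≢multiple zero    ()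
    2≢multiple (suc q) 2≡ = ℕP.<-irrefl 2≡ (ℕP.<-≤-trans (s≤s 2≤K) (ℕP.m≤m+n k (q ℕ.* k)))

-- A sign vector ε ∈ Tuple 2 m encodes the translation a ↦ a ⊕ ε of C_kᵐ moving every
-- coordinate one step, up (↑) or down (↓).
pattern ↑ = zero
pattern ↓ = suc zero

opp : Fin 2 → Fin 2
opp ↑ = ↓
opp ↓ = ↑

sign : Fin 2 → ℤ
sign ↑ = 1ℤ
sign ↓ = -1ℤ

all↑ all↓ : ∀ {m} → Tuple 2 m
all↑ _ = ↑
all↓ _ = ↓

flipAt : ∀ {m} → Fin m → Tuple 2 m → Tuple 2 m
flipAt i ε = updateAt ε i opp

flipAt-same : ∀ {m} (i : Fin m) ε → flipAt i ε i ≡ opp (ε i)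
flipAt-same i ε = updateAt-updates i ε

flipAt-other : ∀ {m} (i : Fin m) ε l → l ≢ i → flipAt i ε l ≡ ε l
flipAt-other i ε l l≢i = updateAt-minimal l i ε l≢i

χ-flipAt-all↑ : ∀ {m} (j i : Fin m) → χ (flipAt j all↑ i ≟ᶠ ↓) ≡ χ (i ≟ᶠ j)
χ-flipAt-all↑ j i = χ-cong flipped⇒same (λ { refl → flipAt-same i all↑ }) (flipAt j all↑ i ≟ᶠ ↓) (i ≟ᶠ j)
  where flipped⇒same : flipAt j all↑ i ≡ ↓ → i ≡ j
        flipped⇒same flipped with i ≟ᶠ j
        ... | yes i≡j = i≡j
        ... | no i≢j  with () ← trans (sym (flipAt-other j all↑ i i≢j)) flipped

SquareProperty : ∀ {m} → (Tuple 2 m → ℤ) → Set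
SquareProperty {m} Φ = ∀ ε (i j : Fin m) → i ≢ j →
  Φ ε + Φ (flipAt i (flipAt j ε)) ≡ Φ (flipAt i ε) + Φ (flipAt j ε)

slope : ∀ {m} → (Tuple 2 m → ℤ) → Fin m → ℤ
slope Φ l = Φ all↑ - Φ (flipAt l all↑)

module _ {m} (Φ : Tuple 2 (suc m) → ℤ) (ext : Extensional Φ) (sq : SquareProperty Φ) where

  private
    Φ[_] : Fin 2 → Tuple 2 m → ℤ
    Φ[ s ] δ = Φ (cons s δ)

  cons-extensional : ∀ s → Extensional Φ[ s ]
  cons-extensional s e = ext (λ { zero → refl ; (suc j) → e j })

  cons-square : ∀ s → SquareProperty Φ[ s ]
  cons-square s δ i j i≢j = begin
    Φ[ s ] δ + Φ[ s ] (flipAt i (flipAt j δ))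
      ≡⟨ cong (_+_ (Φ[ s ] δ)) (ext (λ { zero → refl ; (suc x) → refl })) ⟩
    Φ (cons s δ) + Φ (flipAt (suc i) (flipAt (suc j) (cons s δ)))
      ≡⟨ sq (cons s δ) (suc i) (suc j) (λ e → i≢j (suc-injective e)) ⟩
    Φ (flipAt (suc i) (cons s δ)) + Φ (flipAt (suc j) (cons s δ))
      ≡⟨ cong₂ _+_ (ext (λ { zero → refl ; (suc x) → refl })) (ext (λ { zero → refl ; (suc x) → refl })) ⟩
    Φ[ s ] (flipAt i δ) + Φ[ s ] (flipAt j δ) ∎

  cons-slope : ∀ s l → slope Φ[ s ] l ≡ slope Φ (suc l)
  cons-slope ↑ l = cong₂ _-_ (ext (λ { zero → refl ; (suc x) → refl })) (ext (λ { zero → refl ; (suc x) → refl }))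
  cons-slope ↓ l = begin
    Φ[ ↓ ] all↑ - Φ[ ↓ ] (flipAt l all↑)
      ≡⟨ cong₂ _-_ (ext (λ { zero → refl ; (suc x) → refl })) (ext (λ { zero → refl ; (suc x) → refl })) ⟩
    Φ (flipAt zero all↑) - Φ (flipAt zero (flipAt (suc l) all↑))
      ≡⟨ square⇒ (Φ all↑) (Φ (flipAt zero (flipAt (suc l) all↑))) (Φ (flipAt zero all↑))
                       (Φ (flipAt (suc l) all↑)) (sq all↑ zero (suc l) (λ ())) ⟩
    Φ all↑ - Φ (flipAt (suc l) all↑) ∎
    where square⇒ : ∀ a b c d → a + b ≡ c + d → c - b ≡ a - d
          square⇒ a b c d e = begin
            c - b              ≡⟨ shuffle c b d ⟩
            (c + d) - b - d    ≡⟨ cong (λ z → z - b - d) e ⟨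
            (a + b) - b - d    ≡⟨ cancel a b d ⟩
            a - d              ∎
            where shuffle : ∀ c b d → c - b ≡ (c + d) - b - d
                  shuffle = solve-∀
                  cancel : ∀ a b d → (a + b) - b - d ≡ a - d
                  cancel = solve-∀

  cons-top : ∀ s → Φ[ s ] all↑ + χ (s ≟ᶠ ↓) * slope Φ zero ≡ Φ all↑
  cons-top ↑ = trans (ℤP.+-identityʳ _) (ext (λ { zero → refl ; (suc x) → refl }))
  cons-top ↓ = begin
    Φ[ ↓ ] all↑ + 1ℤ * (Φ all↑ - Φ (flipAt zero all↑))
      ≡⟨ cong (λ z → z + 1ℤ * (Φ all↑ - Φ (flipAt zero all↑))) (ext (λ { zero → refl ; (suc x) → refl })) ⟩
    Φ (flipAt zero all↑) + 1ℤ * (Φ all↑ - Φ (flipAt zero all↑))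
      ≡⟨ cancel (Φ (flipAt zero all↑)) (Φ all↑) ⟩
    Φ all↑ ∎
    where cancel : ∀ a b → a + 1ℤ * (b - a) ≡ b
          cancel = solve-∀

square⇒affine : ∀ m (Φ : Tuple 2 m → ℤ) → Extensional Φ → SquareProperty Φ → ∀ ε →
  Φ ε + ∑[ l ∈ allFinL m ] (χ (ε l ≟ᶠ ↓) * slope Φ l) ≡ Φ all↑
square⇒affine zero    Φ ext sq ε = trans (ℤP.+-identityʳ _) (ext (λ ()))
square⇒affine (suc m) Φ ext sq ε = begin
  Φ ε + ∑[ l ∈ allFinL (suc m) ] (χ (ε l ≟ᶠ ↓) * slope Φ l)
    ≡⟨ cong₂ _+_ (ext (λ j → sym (cons-η ε j))) (sum-allFin-suc m (λ l → χ (ε l ≟ᶠ ↓) * slope Φ l)) ⟩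
  Φ (cons s δ) + (χ (s ≟ᶠ ↓) * slope Φ zero + ∑[ l ∈ allFinL m ] (χ (δ l ≟ᶠ ↓) * slope Φ (suc l)))
    ≡⟨ cong (λ z → Φ (cons s δ) + (χ (s ≟ᶠ ↓) * slope Φ zero + z))
            (sum-cong (allFinL m) (λ l → cong (χ (δ l ≟ᶠ ↓) *_) (sym (cons-slope Φ ext sq s l)))) ⟩
  Φ (cons s δ) + (χ (s ≟ᶠ ↓) * slope Φ zero + ∑[ l ∈ allFinL m ] (χ (δ l ≟ᶠ ↓) * slope Φₛ l))
    ≡⟨ swap (Φ (cons s δ)) (χ (s ≟ᶠ ↓) * slope Φ zero) _ ⟩
  (Φₛ δ + ∑[ l ∈ allFinL m ] (χ (δ l ≟ᶠ ↓) * slope Φₛ l)) + χ (s ≟ᶠ ↓) * slope Φ zero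
    ≡⟨ cong (_+ χ (s ≟ᶠ ↓) * slope Φ zero)
            (square⇒affine m Φₛ (cons-extensional Φ ext sq s) (cons-square Φ ext sq s) δ) ⟩
  Φₛ all↑ + χ (s ≟ᶠ ↓) * slope Φ zero
    ≡⟨ cons-top Φ ext sq s ⟩
  Φ all↑ ∎
  where
  s : Fin 2
  s = ε zero
  δ : Tuple 2 m
  δ j = ε (suc j)
  Φₛ : Tuple 2 m → ℤ
  Φₛ t = Φ (cons s t)
  swap : ∀ a b c → a + (b + c) ≡ (a + c) + b
  swap = solve-∀

square⇒linear : ∀ m (Φ : Tuple 2 m → ℤ) → Extensional Φ → SquareProperty Φ →
  Φ all↓ + Φ all↑ ≡ 0ℤ → ∀ ε → + 2 * Φ ε ≡ ∑[ l ∈ allFinL m ] (sign (ε l) * slope Φ l)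
square⇒linear m Φ ext sq antisym ε = begin
  + 2 * Φ ε
    ≡⟨ combine (Φ ε) X S (Φ all↓) (Φ all↑) (square⇒affine m Φ ext sq ε) all↓-affine antisym ⟩
  S + (- + 2) * X
    ≡⟨ cong (_+_ S) (sum-*ˡ (allFinL m) (- + 2) _) ⟨
  S + ∑[ l ∈ allFinL m ] ((- + 2) * (χ (ε l ≟ᶠ ↓) * slope Φ l))
    ≡⟨ sum-distrib-+ (allFinL m) (slope Φ) _ ⟨
  ∑[ l ∈ allFinL m ] (slope Φ l + (- + 2) * (χ (ε l ≟ᶠ ↓) * slope Φ l))
    ≡⟨ sum-cong (allFinL m) (λ l → sign-as-χ (ε l) (slope Φ l)) ⟩
  ∑[ l ∈ allFinL m ] (sign (ε l) * slope Φ l) ∎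
  where
  X S : ℤ
  X = ∑[ l ∈ allFinL m ] (χ (ε l ≟ᶠ ↓) * slope Φ l)
  S = sumOver (allFinL m) (slope Φ)
  all↓-affine : Φ all↓ + S ≡ Φ all↑
  all↓-affine = trans (cong (_+_ (Φ all↓)) (sum-cong (allFinL m) (λ l → sym (ℤP.*-identityˡ (slope Φ l)))))
                      (square⇒affine m Φ ext sq all↓)
  combine : ∀ φ X S φ↓ φ↑ → φ + X ≡ φ↑ → φ↓ + S ≡ φ↑ → φ↓ + φ↑ ≡ 0ℤ →
            + 2 * φ ≡ S + (- + 2) * X
  combine φ X S φ↓ φ↑ e₁ e₂ e₃ = begin
    + 2 * φ
      ≡⟨ expand φ X S φ↓ φ↑ ⟩
    S + (- + 2) * X + (+ 2 * (φ + X) - (φ↓ + S) - φ↑ + (φ↓ + φ↑))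
      ≡⟨ cong₂ (λ a b → S + (- + 2) * X + (+ 2 * a - b - φ↑ + (φ↓ + φ↑))) e₁ e₂ ⟩
    S + (- + 2) * X + (+ 2 * φ↑ - φ↑ - φ↑ + (φ↓ + φ↑))
      ≡⟨ cong (λ a → S + (- + 2) * X + (+ 2 * φ↑ - φ↑ - φ↑ + a)) e₃ ⟩
    S + (- + 2) * X + (+ 2 * φ↑ - φ↑ - φ↑ + 0ℤ)
      ≡⟨ collapse (S + (- + 2) * X) φ↑ ⟩
    S + (- + 2) * X ∎
    where expand : ∀ φ X S φ↓ φ↑ → + 2 * φ ≡ S + (- + 2) * X + (+ 2 * (φ + X) - (φ↓ + S) - φ↑ + (φ↓ + φ↑))
          expand = solve-∀
          collapse : ∀ a φ↑ → a + (+ 2 * φ↑ - φ↑ - φ↑ + 0ℤ) ≡ a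
          collapse = solve-∀
  sign-as-χ : ∀ s c → c + (- + 2) * (χ (s ≟ᶠ ↓) * c) ≡ sign s * c
  sign-as-χ ↑ c = lemma c
    where lemma : ∀ c → c + (- + 2) * (0ℤ * c) ≡ 1ℤ * c
          lemma = solve-∀
  sign-as-χ ↓ c = lemma c
    where lemma : ∀ c → c + (- + 2) * (1ℤ * c) ≡ -1ℤ * c
          lemma = solve-∀

sum-signVectors-suc : ∀ n (F : Tuple 2 (suc n) → ℤ) →
  sumOver (allTuples 2 (suc n)) F ≡ ∑[ t ∈ allTuples 2 n ] F (cons ↑ t) + ∑[ t ∈ allTuples 2 n ] F (cons ↓ t)
sum-signVectors-suc n F =
  trans (sum-allTuples-suc 2 n F) (cong (_+_ (∑[ t ∈ allTuples 2 n ] F (cons ↑ t))) (ℤP.+-identityʳ _))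

sum-sign : ∀ n (l : Fin n) → ∑[ ε ∈ allTuples 2 n ] sign (ε l) ≡ 0ℤ
sum-sign (suc n) zero = begin
  ∑[ ε ∈ allTuples 2 (suc n) ] sign (ε zero)
    ≡⟨ sum-signVectors-suc n _ ⟩
  ∑[ _ ∈ allTuples 2 n ] 1ℤ + ∑[ _ ∈ allTuples 2 n ] -1ℤ
    ≡⟨ cong₂ _+_ (sum-allTuples-const 2 n 1ℤ) (sum-allTuples-const 2 n -1ℤ) ⟩
  + (2 ℕ.^ n) * 1ℤ + + (2 ℕ.^ n) * -1ℤ
    ≡⟨ cancel (+ (2 ℕ.^ n)) ⟩
  0ℤ ∎
  where cancel : ∀ x → x * 1ℤ + x * -1ℤ ≡ 0ℤ
        cancel = solve-∀
sum-sign (suc n) (suc l) = begin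
  ∑[ ε ∈ allTuples 2 (suc n) ] sign (ε (suc l))                         ≡⟨ sum-signVectors-suc n _ ⟩
  ∑[ t ∈ allTuples 2 n ] sign (t l) + ∑[ t ∈ allTuples 2 n ] sign (t l)  ≡⟨ cong₂ _+_ (sum-sign n l) (sum-sign n l) ⟩
  0ℤ                                                                     ∎

+2^n++2^n : ∀ n → + (2 ℕ.^ n) + + (2 ℕ.^ n) ≡ + (2 ℕ.^ suc n)
+2^n++2^n n = trans (sym (ℤP.pos-+ (2 ℕ.^ n) (2 ℕ.^ n)))
                    (cong (λ z → + (2 ℕ.^ n ℕ.+ z)) (sym (ℕP.+-identityʳ (2 ℕ.^ n))))

sum-χ-coordinate : ∀ n (i : Fin (suc n)) s → ∑[ ε ∈ allTuples 2 (suc n) ] χ (ε i ≟ᶠ s) ≡ + (2 ℕ.^ n)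
sum-χ-coordinate n zero s = begin
  ∑[ ε ∈ allTuples 2 (suc n) ] χ (ε zero ≟ᶠ s)
    ≡⟨ sum-signVectors-suc n _ ⟩
  ∑[ _ ∈ allTuples 2 n ] χ (↑ ≟ᶠ s) + ∑[ _ ∈ allTuples 2 n ] χ (↓ ≟ᶠ s)
    ≡⟨ cong₂ _+_ (sum-allTuples-const 2 n _) (sum-allTuples-const 2 n _) ⟩
  + (2 ℕ.^ n) * χ (↑ ≟ᶠ s) + + (2 ℕ.^ n) * χ (↓ ≟ᶠ s)
    ≡⟨ ℤP.*-distribˡ-+ (+ (2 ℕ.^ n)) _ _ ⟨
  + (2 ℕ.^ n) * (χ (↑ ≟ᶠ s) + χ (↓ ≟ᶠ s))
    ≡⟨ cong (+ (2 ℕ.^ n) *_) (exactly-one s) ⟩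
  + (2 ℕ.^ n) * 1ℤ
    ≡⟨ ℤP.*-identityʳ _ ⟩
  + (2 ℕ.^ n) ∎
  where exactly-one : ∀ s → χ (↑ ≟ᶠ s) + χ (↓ ≟ᶠ s) ≡ 1ℤ
        exactly-one ↑ = refl
        exactly-one ↓ = refl
sum-χ-coordinate (suc n) (suc i) s = begin
  ∑[ ε ∈ allTuples 2 (suc (suc n)) ] χ (ε (suc i) ≟ᶠ s)
    ≡⟨ sum-signVectors-suc (suc n) _ ⟩
  ∑[ t ∈ allTuples 2 (suc n) ] χ (t i ≟ᶠ s) + ∑[ t ∈ allTuples 2 (suc n) ] χ (t i ≟ᶠ s)
    ≡⟨ cong₂ _+_ (sum-χ-coordinate n i s) (sum-χ-coordinate n i s) ⟩
  + (2 ℕ.^ n) + + (2 ℕ.^ n)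
    ≡⟨ +2^n++2^n n ⟩
  + (2 ℕ.^ suc n) ∎

sum-χ↑-sign : ∀ n (i l : Fin (suc n)) →
  ∑[ ε ∈ allTuples 2 (suc n) ] (χ (ε i ≟ᶠ ↑) * sign (ε l)) ≡ χ (l ≟ᶠ i) * + (2 ℕ.^ n)
sum-χ↑-sign n zero zero = begin
  ∑[ ε ∈ allTuples 2 (suc n) ] (χ (ε zero ≟ᶠ ↑) * sign (ε zero))
    ≡⟨ sum-signVectors-suc n _ ⟩
  ∑[ _ ∈ allTuples 2 n ] (1ℤ * 1ℤ) + ∑[ _ ∈ allTuples 2 n ] (0ℤ * -1ℤ)
    ≡⟨ cong₂ _+_ (sum-allTuples-const 2 n _) (sum-allTuples-const 2 n _) ⟩
  + (2 ℕ.^ n) * (1ℤ * 1ℤ) + + (2 ℕ.^ n) * (0ℤ * -1ℤ)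
    ≡⟨ simplify (+ (2 ℕ.^ n)) ⟩
  1ℤ * + (2 ℕ.^ n) ∎
  where simplify : ∀ x → x * (1ℤ * 1ℤ) + x * (0ℤ * -1ℤ) ≡ 1ℤ * x
        simplify = solve-∀
sum-χ↑-sign n zero (suc l) = begin
  ∑[ ε ∈ allTuples 2 (suc n) ] (χ (ε zero ≟ᶠ ↑) * sign (ε (suc l)))
    ≡⟨ sum-signVectors-suc n _ ⟩
  ∑[ t ∈ allTuples 2 n ] (1ℤ * sign (t l)) + ∑[ t ∈ allTuples 2 n ] (0ℤ * sign (t l))
    ≡⟨ cong₂ _+_ (trans (sum-*ˡ (allTuples 2 n) 1ℤ (λ t → sign (t l))) (cong (1ℤ *_) (sum-sign n l)))
                 (trans (sum-*ˡ (allTuples 2 n) 0ℤ (λ t → sign (t l)))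
                        (ℤP.*-zeroˡ (∑[ t ∈ allTuples 2 n ] sign (t l)))) ⟩
  0ℤ ∎
sum-χ↑-sign n (suc i) zero = begin
  ∑[ ε ∈ allTuples 2 (suc n) ] (χ (ε (suc i) ≟ᶠ ↑) * sign (ε zero))
    ≡⟨ sum-signVectors-suc n _ ⟩
  ∑[ t ∈ allTuples 2 n ] (χ (t i ≟ᶠ ↑) * 1ℤ) + ∑[ t ∈ allTuples 2 n ] (χ (t i ≟ᶠ ↑) * -1ℤ)
    ≡⟨ sum-distrib-+ (allTuples 2 n) _ _ ⟨
  ∑[ t ∈ allTuples 2 n ] (χ (t i ≟ᶠ ↑) * 1ℤ + χ (t i ≟ᶠ ↑) * -1ℤ)
    ≡⟨ sum-cong (allTuples 2 n) (λ t → cancel (χ (t i ≟ᶠ ↑))) ⟩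
  ∑[ t ∈ allTuples 2 n ] 0ℤ
    ≡⟨ sum-0 (allTuples 2 n) ⟩
  0ℤ ∎
  where cancel : ∀ x → x * 1ℤ + x * -1ℤ ≡ 0ℤ
        cancel = solve-∀
sum-χ↑-sign (suc n) (suc i) (suc l) = begin
  ∑[ ε ∈ allTuples 2 (suc (suc n)) ] (χ (ε (suc i) ≟ᶠ ↑) * sign (ε (suc l)))
    ≡⟨ sum-signVectors-suc (suc n) _ ⟩
  ∑[ t ∈ allTuples 2 (suc n) ] (χ (t i ≟ᶠ ↑) * sign (t l))
    + ∑[ t ∈ allTuples 2 (suc n) ] (χ (t i ≟ᶠ ↑) * sign (t l))
    ≡⟨ cong₂ _+_ (sum-χ↑-sign n i l) (sum-χ↑-sign n i l) ⟩
  χ (l ≟ᶠ i) * + (2 ℕ.^ n) + χ (l ≟ᶠ i) * + (2 ℕ.^ n)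
    ≡⟨ ℤP.*-distribˡ-+ (χ (l ≟ᶠ i)) _ _ ⟨
  χ (l ≟ᶠ i) * (+ (2 ℕ.^ n) + + (2 ℕ.^ n))
    ≡⟨ cong₂ _*_ (χ-cong (cong suc) suc-injective (l ≟ᶠ i) (suc l ≟ᶠ suc i)) (+2^n++2^n n) ⟩
  χ (suc l ≟ᶠ suc i) * + (2 ℕ.^ suc n) ∎

sum-χ↑-linear : ∀ n (i : Fin (suc n)) (c : Fin (suc n) → ℤ) →
  ∑[ ε ∈ allTuples 2 (suc n) ] (χ (ε i ≟ᶠ ↑) * ∑[ l ∈ allFinL (suc n) ] (sign (ε l) * c l))
    ≡ + (2 ℕ.^ n) * c i
sum-χ↑-linear n i c = begin
  ∑[ ε ∈ signs ] (χ (ε i ≟ᶠ ↑) * ∑[ l ∈ coords ] (sign (ε l) * c l))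
    ≡⟨ sum-cong signs (λ ε → sym (sum-*ˡ coords (χ (ε i ≟ᶠ ↑)) _)) ⟩
  ∑[ ε ∈ signs ] ∑[ l ∈ coords ] (χ (ε i ≟ᶠ ↑) * (sign (ε l) * c l))
    ≡⟨ sum-comm signs coords _ ⟩
  ∑[ l ∈ coords ] ∑[ ε ∈ signs ] (χ (ε i ≟ᶠ ↑) * (sign (ε l) * c l))
    ≡⟨ sum-cong coords (λ l → trans (sum-cong signs (λ ε → reorder (χ (ε i ≟ᶠ ↑)) (sign (ε l)) (c l)))
                                    (sum-*ˡ signs (c l) _)) ⟩
  ∑[ l ∈ coords ] (c l * ∑[ ε ∈ signs ] (χ (ε i ≟ᶠ ↑) * sign (ε l)))
    ≡⟨ sum-cong coords (λ l → trans (cong (c l *_) (sum-χ↑-sign n i l)) (reorder′ (c l) (χ (l ≟ᶠ i)) _)) ⟩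
  ∑[ l ∈ coords ] (χ (l ≟ᶠ i) * (+ (2 ℕ.^ n) * c l))
    ≡⟨ sum-allFin-δ (suc n) i _ ⟩
  + (2 ℕ.^ n) * c i ∎
  where
  signs : List (Tuple 2 (suc n))
  signs = allTuples 2 (suc n)
  coords : List (Fin (suc n))
  coords = allFinL (suc n)
  reorder : ∀ a b c → a * (b * c) ≡ c * (a * b)
  reorder = solve-∀
  reorder′ : ∀ c a x → c * (a * x) ≡ a * (x * c)
  reorder′ = solve-∀

pattern c₀ = zero
pattern c₁ = suc zero
pattern c₂ = suc (suc zero)

circulation : Chain (Fin 3) → ℤ
circulation s = coef s c₀ c₁ + coef s c₁ c₂ + coef s c₂ c₀

-- The winding of the edge [x,y] around C₃: 1 along O₃, -1 against it, 0 on a loop.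
wind : Fin 3 → Fin 3 → ℤ
wind x y = circulation ((1ℤ , x , y) ∷ [])

C₃-irreflexive : ∀ x → ¬ Adj 3 x x
C₃-irreflexive = toWitness {a? = all? λ x → ¬? (adj? 3 x x)} _

wind-antisym : ∀ x y → wind y x ≡ - wind x y
wind-antisym = toWitness {a? = all? λ x → all? λ y → wind y x ℤP.≟ - wind x y} _

wind-square : ∀ a b c d → Adj 3 a b → Adj 3 b c → Adj 3 a d → Adj 3 d c →
              wind a b + wind b c ≡ wind a d + wind d c
wind-square = toWitness {a? = all? λ a → all? λ b → all? λ c → all? λ d →
  adj? 3 a b →-dec adj? 3 b c →-dec adj? 3 a d →-dec adj? 3 d c →-dec
  (wind a b + wind b c ℤP.≟ wind a d + wind d c)} _

circulation-cong : ∀ {s t} → s ≈E t → circulation s ≡ circulation t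
circulation-cong s≈t = cong₂ _+_ (cong₂ _+_ (s≈t c₀ c₁) (s≈t c₁ c₂)) (s≈t c₂ c₀)

coef-∷ : ∀ {m} e (s : Chain (Fin m)) u v → coef (e ∷ s) u v ≡ coef (e ∷ []) u v + coef s u v
coef-∷ (c , x , y) s u v = regroup (if ⌊ (x ≟ᶠ u) ×-dec (y ≟ᶠ v) ⌋ then c else 0ℤ)
                                   (if ⌊ (x ≟ᶠ v) ×-dec (y ≟ᶠ u) ⌋ then - c else 0ℤ) (coef s u v)
  where regroup : ∀ a b c → a + (b + c) ≡ a + (b + 0ℤ) + c
        regroup = solve-∀

circulation-∷ : ∀ e s → circulation (e ∷ s) ≡ circulation (e ∷ []) + circulation s
circulation-∷ e s = begin
  coef (e ∷ s) c₀ c₁ + coef (e ∷ s) c₁ c₂ + coef (e ∷ s) c₂ c₀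
    ≡⟨ cong₂ _+_ (cong₂ _+_ (coef-∷ e s c₀ c₁) (coef-∷ e s c₁ c₂)) (coef-∷ e s c₂ c₀) ⟩
  (coef [ e ] c₀ c₁ + coef s c₀ c₁) + (coef [ e ] c₁ c₂ + coef s c₁ c₂) + (coef [ e ] c₂ c₀ + coef s c₂ c₀)
    ≡⟨ regroup (coef [ e ] c₀ c₁) _ (coef [ e ] c₁ c₂) _ (coef [ e ] c₂ c₀) _ ⟩
  circulation [ e ] + circulation s ∎
  where regroup : ∀ a p b q c r → (a + p) + (b + q) + (c + r) ≡ (a + b + c) + (p + q + r)
        regroup = solve-∀

circulation-mapE : ∀ {V : Set} (f : V → Fin 3) (L : List (V × V)) →
  circulation (mapE f (setChain L)) ≡ ∑[ e ∈ L ] wind (f (proj₁ e)) (f (proj₂ e))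
circulation-mapE f []            = refl
circulation-mapE f ((a , b) ∷ L) =
  trans (circulation-∷ (1ℤ , f a , f b) (mapE f (setChain L))) (cong (_+_ (wind (f a) (f b))) (circulation-mapE f L))

coef-scale : ∀ {m} z (s : Chain (Fin m)) u v → coef (z ·E s) u v ≡ z * coef s u v
coef-scale z []              u v = sym (ℤP.*-zeroʳ z)
coef-scale z ((c , x , y) ∷ s) u v =
  trans (cong₂ _+_ (if-scale ⌊ (x ≟ᶠ u) ×-dec (y ≟ᶠ v) ⌋ c)
                   (cong₂ _+_ (trans (cong (λ w → if ⌊ (x ≟ᶠ v) ×-dec (y ≟ᶠ u) ⌋ then w else 0ℤ)
                                           (ℤP.neg-distribʳ-* z c))
                                     (if-scale ⌊ (x ≟ᶠ v) ×-dec (y ≟ᶠ u) ⌋ (- c)))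
                              (coef-scale z s u v)))
        (distrib z (if ⌊ (x ≟ᶠ u) ×-dec (y ≟ᶠ v) ⌋ then c else 0ℤ)
                   (if ⌊ (x ≟ᶠ v) ×-dec (y ≟ᶠ u) ⌋ then - c else 0ℤ) (coef s u v))
  where
  if-scale : ∀ b c → (if b then z * c else 0ℤ) ≡ z * (if b then c else 0ℤ)
  if-scale true  c = refl
  if-scale false c = sym (ℤP.*-zeroʳ z)
  distrib : ∀ z a b c → z * a + (z * b + z * c) ≡ z * (a + (b + c))
  distrib = solve-∀

circulation-O₃ : ∀ z → circulation (z ·E O3) ≡ + 3 * z
circulation-O₃ z = begin
  coef (z ·E O3) c₀ c₁ + coef (z ·E O3) c₁ c₂ + coef (z ·E O3) c₂ c₀
    ≡⟨ cong₂ _+_ (cong₂ _+_ (coef-scale z O3 c₀ c₁) (coef-scale z O3 c₁ c₂)) (coef-scale z O3 c₂ c₀) ⟩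
  z * coef O3 c₀ c₁ + z * coef O3 c₁ c₂ + z * coef O3 c₂ c₀
    ≡⟨ triple z ⟩
  + 3 * z ∎
  where triple : ∀ z → z * 1ℤ + z * 1ℤ + z * 1ℤ ≡ + 3 * z
        triple = solve-∀

module Polymorphisms (K : ℕ) (2≤K : 2 ℕ.≤ K) where

  open Cycle K public

  step : Fin 2 → Fin k → Fin k
  step ↑ = up
  step ↓ = down

  step-opp : ∀ s x → step (opp s) (step s x) ≡ x
  step-opp ↑ = down-up
  step-opp ↓ = up-down

  opp-step : ∀ s x → step s (step (opp s) x) ≡ x
  opp-step ↑ = up-down
  opp-step ↓ = down-up

  step-comm : ∀ s s′ x → step s (step s′ x) ≡ step s′ (step s x)
  step-comm ↑ ↑ x = refl
  step-comm ↑ ↓ x = shift-comm 1 K x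
  step-comm ↓ ↑ x = shift-comm K 1 x
  step-comm ↓ ↓ x = refl

  step-shift : ∀ r s x → step s (shift r x) ≡ shift r (step s x)
  step-shift r ↑ x = shift-comm 1 r x
  step-shift r ↓ x = shift-comm K r x

  shift-toℕ-step : ∀ s y z → shift (toℕ (step s y)) z ≡ step s (shift (toℕ y) z)
  shift-toℕ-step ↑ = shift-toℕ-shift 1
  shift-toℕ-step ↓ = shift-toℕ-shift K

  adj-step : ∀ s x → Adj k x (step s x)
  adj-step ↑ x = inj₁ (next-up x)
  adj-step ↓ x = inj₂ (next-down x)

  adj⇒step : ∀ {x y} → Adj k x y → (y ≡ up x) ⊎ (y ≡ down x)
  adj⇒step (inj₁ n) = inj₁ (next⇒up n)
  adj⇒step (inj₂ n) = inj₂ (next⇒down n)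

  χ-next-step : ∀ s x → χ (next? k x (step s x)) ≡ χ (s ≟ᶠ ↑)
  χ-next-step ↑ x = χ-yes (next? k x (up x)) (next-up x)
  χ-next-step ↓ x = χ-no (next? k x (down x)) (λ n → up≢down 2≤K x (sym (next⇒up n)))

  χ-step-next : ∀ s x → χ (next? k (step s x) x) ≡ χ (s ≟ᶠ ↓)
  χ-step-next ↑ x = χ-no (next? k (up x) x) (λ n → up≢down 2≤K x (next⇒down n))
  χ-step-next ↓ x = χ-yes (next? k (down x) x) (next-down x)

  infixl 6 _⊕_
  _⊕_ : ∀ {m} → Tuple k m → Tuple 2 m → Tuple k m
  (a ⊕ ε) j = step (ε j) (a j)

  adjPow-⊕ : ∀ {m} (a : Tuple k m) ε → AdjPow k m a (a ⊕ ε)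
  adjPow-⊕ a ε j = adj-step (ε j) (a j)

  sum-translate : ∀ m (ε : Tuple 2 m) (F : Tuple k m → ℤ) → Extensional F →
                  ∑[ a ∈ allTuples k m ] F (a ⊕ ε) ≡ sumOver (allTuples k m) F
  sum-translate m ε = sum-allTuples-bijection k m (λ j → step (ε j)) (λ j → step (opp (ε j)))
                                              (λ j → step-opp (ε j)) (λ j → opp-step (ε j))

  sum-adjacent : ∀ x (H : Fin k → ℤ) →
                 ∑[ y ∈ allFinL k ] (χ (adj? k x y) * H y) ≡ ∑[ s ∈ allFinL 2 ] H (step s x)
  sum-adjacent x H = begin
    ∑[ y ∈ allFinL k ] (χ (adj? k x y) * H y)
      ≡⟨ sum-cong (allFinL k) (λ y → trans (cong (_* H y) (χ-adj y)) (ℤP.*-distribʳ-+ (H y) (χ (y ≟ᶠ up x)) _)) ⟩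
    ∑[ y ∈ allFinL k ] (χ (y ≟ᶠ up x) * H y + χ (y ≟ᶠ down x) * H y)
      ≡⟨ sum-distrib-+ (allFinL k) (λ y → χ (y ≟ᶠ up x) * H y) (λ y → χ (y ≟ᶠ down x) * H y) ⟩
    ∑[ y ∈ allFinL k ] (χ (y ≟ᶠ up x) * H y) + ∑[ y ∈ allFinL k ] (χ (y ≟ᶠ down x) * H y)
      ≡⟨ cong₂ _+_ (sum-allFin-δ k (up x) H) (sum-allFin-δ k (down x) H) ⟩
    H (up x) + H (down x)
      ≡⟨ cong (_+_ (H (up x))) (ℤP.+-identityʳ (H (down x))) ⟨
    ∑[ s ∈ allFinL 2 ] H (step s x) ∎
    where
    χ-adj : ∀ y → χ (adj? k x y) ≡ χ (y ≟ᶠ up x) + χ (y ≟ᶠ down x)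
    χ-adj y with y ≟ᶠ up x | y ≟ᶠ down x
    ... | yes y≡up | yes y≡down = ⊥-elim (up≢down 2≤K x (trans (sym y≡up) y≡down))
    ... | yes y≡up | no _       = χ-yes (adj? k x y) (subst (Adj k x) (sym y≡up) (adj-step ↑ x))
    ... | no _     | yes y≡down = χ-yes (adj? k x y) (subst (Adj k x) (sym y≡down) (adj-step ↓ x))
    ... | no y≢up  | no y≢down  = χ-no (adj? k x y) ([ y≢up , y≢down ]′ ∘ adj⇒step)

  sum-neighbours : ∀ n (a : Tuple k n) (G : Tuple k n → ℤ) → Extensional G →
    ∑[ b ∈ allTuples k n ] (χ (adjPow? k n a b) * G b) ≡ ∑[ ε ∈ allTuples 2 n ] G (a ⊕ ε)
  sum-neighbours zero    a G ext =
    cong (_+ 0ℤ) (trans (cong (1ℤ *_) (ext (λ ()))) (ℤP.*-identityˡ _))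
  sum-neighbours (suc n) a G ext = begin
    ∑[ b ∈ allTuples k (suc n) ] (χ (adjPow? k (suc n) a b) * G b)
      ≡⟨ sum-allTuples-suc k n _ ⟩
    ∑[ y ∈ allFinL k ] ∑[ t ∈ allTuples k n ] (χ (adjPow? k (suc n) a (cons y t)) * G (cons y t))
      ≡⟨ sum-cong (allFinL k) (λ y → sum-cong (allTuples k n) (λ t → split y t)) ⟩
    ∑[ y ∈ allFinL k ] ∑[ t ∈ allTuples k n ] (χ (adj? k (a zero) y) * (χ (adjPow? k n a′ t) * G (cons y t)))
      ≡⟨ sum-cong (allFinL k) (λ y → sum-*ˡ (allTuples k n) (χ (adj? k (a zero) y)) _) ⟩
    ∑[ y ∈ allFinL k ] (χ (adj? k (a zero) y) * ∑[ t ∈ allTuples k n ] (χ (adjPow? k n a′ t) * G (cons y t)))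
      ≡⟨ sum-cong (allFinL k) (λ y → cong (χ (adj? k (a zero) y) *_)
           (sum-neighbours n a′ (λ t → G (cons y t)) (λ e → ext (λ { zero → refl ; (suc j) → e j })))) ⟩
    ∑[ y ∈ allFinL k ] (χ (adj? k (a zero) y) * ∑[ δ ∈ allTuples 2 n ] G (cons y (a′ ⊕ δ)))
      ≡⟨ sum-adjacent (a zero) (λ y → ∑[ δ ∈ allTuples 2 n ] G (cons y (a′ ⊕ δ))) ⟩
    ∑[ s ∈ allFinL 2 ] ∑[ δ ∈ allTuples 2 n ] G (cons (step s (a zero)) (a′ ⊕ δ))
      ≡⟨ sum-cong (allFinL 2) (λ s → sum-cong (allTuples 2 n) (λ δ →
           ext {cons (step s (a zero)) (a′ ⊕ δ)} {a ⊕ cons s δ} (λ { zero → refl ; (suc j) → refl }))) ⟩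
    ∑[ s ∈ allFinL 2 ] ∑[ δ ∈ allTuples 2 n ] G (a ⊕ cons s δ)
      ≡⟨ sum-allTuples-suc 2 n _ ⟨
    ∑[ ε ∈ allTuples 2 (suc n) ] G (a ⊕ ε) ∎
    where
    a′ : Tuple k n
    a′ j = a (suc j)
    split : ∀ y t → χ (adjPow? k (suc n) a (cons y t)) * G (cons y t)
                  ≡ χ (adj? k (a zero) y) * (χ (adjPow? k n a′ t) * G (cons y t))
    split y t = trans (cong (_* G (cons y t)) (χ-all? (λ j → adj? k (a j) (cons y t j))))
                      (ℤP.*-assoc (χ (adj? k (a zero) y)) (χ (adjPow? k n a′ t)) (G (cons y t)))

  succ? : ∀ {n} (i : Fin n) (a b : Tuple k n) → Dec (AdjPow k n a b × Next k (a i) (b i))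
  succ? {n} i a b = adjPow? k n a b ×-dec next? k (a i) (b i)

  sum-successors : ∀ n (i : Fin n) (a : Tuple k n) (G : Tuple k n → ℤ) → Extensional G →
    ∑[ b ∈ allTuples k n ] (χ (succ? i a b) * G b) ≡ ∑[ ε ∈ allTuples 2 n ] (χ (ε i ≟ᶠ ↑) * G (a ⊕ ε))
  sum-successors n i a G ext = begin
    ∑[ b ∈ allTuples k n ] (χ (succ? i a b) * G b)
      ≡⟨ sum-cong (allTuples k n) (λ b → trans (cong (_* G b) (χ-× (adjPow? k n a b) (next? k (a i) (b i))))
                                             (ℤP.*-assoc (χ (adjPow? k n a b)) (χ (next? k (a i) (b i))) (G b))) ⟩
    ∑[ b ∈ allTuples k n ] (χ (adjPow? k n a b) * (χ (next? k (a i) (b i)) * G b))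
      ≡⟨ sum-neighbours n a (λ b → χ (next? k (a i) (b i)) * G b)
                        (λ e → cong₂ _*_ (cong (λ y → χ (next? k (a i) y)) (e i)) (ext e)) ⟩
    ∑[ ε ∈ allTuples 2 n ] (χ (next? k (a i) (step (ε i) (a i))) * G (a ⊕ ε))
      ≡⟨ sum-cong (allTuples 2 n) (λ ε → cong (_* G (a ⊕ ε)) (χ-next-step (ε i) (a i))) ⟩
    ∑[ ε ∈ allTuples 2 n ] (χ (ε i ≟ᶠ ↑) * G (a ⊕ ε)) ∎

  sum-predecessors : ∀ n (i : Fin n) (b : Tuple k n) (G : Tuple k n → ℤ) → Extensional G →
    ∑[ a ∈ allTuples k n ] (χ (succ? i a b) * G a) ≡ ∑[ ε ∈ allTuples 2 n ] (χ (ε i ≟ᶠ ↓) * G (b ⊕ ε))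
  sum-predecessors n i b G ext = begin
    ∑[ a ∈ allTuples k n ] (χ (succ? i a b) * G a)
      ≡⟨ sum-cong (allTuples k n) split ⟩
    ∑[ a ∈ allTuples k n ] (χ (adjPow? k n b a) * (χ (next? k (a i) (b i)) * G a))
      ≡⟨ sum-neighbours n b (λ a → χ (next? k (a i) (b i)) * G a)
                        (λ e → cong₂ _*_ (cong (λ x → χ (next? k x (b i))) (e i)) (ext e)) ⟩
    ∑[ ε ∈ allTuples 2 n ] (χ (next? k (step (ε i) (b i)) (b i)) * G (b ⊕ ε))
      ≡⟨ sum-cong (allTuples 2 n) (λ ε → cong (_* G (b ⊕ ε)) (χ-step-next (ε i) (b i))) ⟩
    ∑[ ε ∈ allTuples 2 n ] (χ (ε i ≟ᶠ ↓) * G (b ⊕ ε)) ∎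
    where
    swap : ∀ {x y} → AdjPow k n x y → AdjPow k n y x
    swap adj j = [ inj₂ , inj₁ ]′ (adj j)
    split : ∀ a → χ (succ? i a b) * G a ≡ χ (adjPow? k n b a) * (χ (next? k (a i) (b i)) * G a)
    split a = begin
      χ (succ? i a b) * G a
        ≡⟨ cong (_* G a) (χ-× (adjPow? k n a b) (next? k (a i) (b i))) ⟩
      χ (adjPow? k n a b) * χ (next? k (a i) (b i)) * G a
        ≡⟨ cong (λ c → c * χ (next? k (a i) (b i)) * G a) (χ-cong swap swap (adjPow? k n a b) (adjPow? k n b a)) ⟩
      χ (adjPow? k n b a) * χ (next? k (a i) (b i)) * G a
        ≡⟨ ℤP.*-assoc (χ (adjPow? k n b a)) (χ (next? k (a i) (b i))) (G a) ⟩
      χ (adjPow? k n b a) * (χ (next? k (a i) (b i)) * G a) ∎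

  out-degree : ∀ n (i : Fin (suc n)) a → ∑[ b ∈ allTuples k (suc n) ] χ (succ? i a b) ≡ + (2 ℕ.^ n)
  out-degree n i a = begin
    ∑[ b ∈ allTuples k (suc n) ] χ (succ? i a b)
      ≡⟨ sum-cong (allTuples k (suc n)) (λ b → sym (ℤP.*-identityʳ _)) ⟩
    ∑[ b ∈ allTuples k (suc n) ] (χ (succ? i a b) * 1ℤ)
      ≡⟨ sum-successors (suc n) i a (λ _ → 1ℤ) (λ _ → refl) ⟩
    ∑[ ε ∈ allTuples 2 (suc n) ] (χ (ε i ≟ᶠ ↑) * 1ℤ)
      ≡⟨ sum-cong (allTuples 2 (suc n)) (λ ε → ℤP.*-identityʳ _) ⟩
    ∑[ ε ∈ allTuples 2 (suc n) ] χ (ε i ≟ᶠ ↑)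
      ≡⟨ sum-χ-coordinate n i ↑ ⟩
    + (2 ℕ.^ n) ∎

  in-degree : ∀ n (i : Fin (suc n)) b → ∑[ a ∈ allTuples k (suc n) ] χ (succ? i a b) ≡ + (2 ℕ.^ n)
  in-degree n i b = begin
    ∑[ a ∈ allTuples k (suc n) ] χ (succ? i a b)
      ≡⟨ sum-cong (allTuples k (suc n)) (λ a → sym (ℤP.*-identityʳ _)) ⟩
    ∑[ a ∈ allTuples k (suc n) ] (χ (succ? i a b) * 1ℤ)
      ≡⟨ sum-predecessors (suc n) i b (λ _ → 1ℤ) (λ _ → refl) ⟩
    ∑[ ε ∈ allTuples 2 (suc n) ] (χ (ε i ≟ᶠ ↓) * 1ℤ)
      ≡⟨ sum-cong (allTuples 2 (suc n)) (λ ε → ℤP.*-identityʳ _) ⟩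
    ∑[ ε ∈ allTuples 2 (suc n) ] χ (ε i ≟ᶠ ↓)
      ≡⟨ sum-χ-coordinate n i ↓ ⟩
    + (2 ℕ.^ n) ∎

  edgeWinding : ∀ {n} → Fin n → (Tuple k n → Fin 3) → ℤ
  edgeWinding {n} i h = ∑[ a ∈ allTuples k n ] ∑[ b ∈ allTuples k n ] (χ (succ? i a b) * wind (h a) (h b))

  diagWinding : ∀ {n} → (Tuple k n → Fin 3) → Tuple 2 n → ℤ
  diagWinding {n} h ε = ∑[ a ∈ allTuples k n ] wind (h a) (h (a ⊕ ε))

  edgeWinding-Oedges : ∀ n (i : Fin n) (h : Tuple k n → Fin 3) →
    ∑[ e ∈ Oedges k n i ] wind (h (proj₁ e)) (h (proj₂ e)) ≡ edgeWinding i h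
  edgeWinding-Oedges n i h = begin
    ∑[ e ∈ Oedges k n i ] wind (h (proj₁ e)) (h (proj₂ e))
      ≡⟨ sum-filter (λ e → succ? i (proj₁ e) (proj₂ e)) pairs _ ⟩
    ∑[ e ∈ pairs ] (χ (succ? i (proj₁ e) (proj₂ e)) * wind (h (proj₁ e)) (h (proj₂ e)))
      ≡⟨ sum-concatMap (λ a → map (a ,_) (allTuples k n)) (allTuples k n) _ ⟩
    ∑[ a ∈ allTuples k n ] sumOver (map (a ,_) (allTuples k n))
                                   (λ e → χ (succ? i (proj₁ e) (proj₂ e)) * wind (h (proj₁ e)) (h (proj₂ e)))
      ≡⟨ sum-cong (allTuples k n) (λ a → sum-map (a ,_) (allTuples k n) _) ⟩
    edgeWinding i h ∎
    where pairs : List (Tuple k n × Tuple k n)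
          pairs = concatMap (λ a → map (λ b → (a , b)) (allTuples k n)) (allTuples k n)

  degree⇒edgeWinding : ∀ n (i : Fin n) (h : Tuple k n → Fin 3) d → IsDeg k n h i d →
    edgeWinding i h ≡ + 3 * (+ ((2 ℕ.* k) ℕ.^ (n ℕ.∸ 1)) * d)
  degree⇒edgeWinding n i h d deg = begin
    edgeWinding i h                                           ≡⟨ edgeWinding-Oedges n i h ⟨
    ∑[ e ∈ Oedges k n i ] wind (h (proj₁ e)) (h (proj₂ e))    ≡⟨ circulation-mapE h (Oedges k n i) ⟨
    circulation (mapE h (O^ k n i))                           ≡⟨ circulation-cong {mapE h (O^ k n i)} {c ·E O3} deg ⟩
    circulation (c ·E O3)                                     ≡⟨ circulation-O₃ c ⟩
    + 3 * c                                                   ∎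
    where c : ℤ
          c = + ((2 ℕ.* k) ℕ.^ (n ℕ.∸ 1)) * d

  edgeWinding-diagWinding : ∀ n (i : Fin n) (h : Tuple k n → Fin 3) → Extensional h →
    edgeWinding i h ≡ ∑[ ε ∈ allTuples 2 n ] (χ (ε i ≟ᶠ ↑) * diagWinding h ε)
  edgeWinding-diagWinding n i h ext = begin
    edgeWinding i h
      ≡⟨ sum-cong (allTuples k n) (λ a → sum-successors n i a (λ b → wind (h a) (h b)) (cong (wind (h a)) ∘ ext)) ⟩
    ∑[ a ∈ allTuples k n ] ∑[ ε ∈ allTuples 2 n ] (χ (ε i ≟ᶠ ↑) * wind (h a) (h (a ⊕ ε)))
      ≡⟨ sum-comm (allTuples k n) (allTuples 2 n) _ ⟩
    ∑[ ε ∈ allTuples 2 n ] ∑[ a ∈ allTuples k n ] (χ (ε i ≟ᶠ ↑) * wind (h a) (h (a ⊕ ε)))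
      ≡⟨ sum-cong (allTuples 2 n) (λ ε → sum-*ˡ (allTuples k n) (χ (ε i ≟ᶠ ↑)) _) ⟩
    ∑[ ε ∈ allTuples 2 n ] (χ (ε i ≟ᶠ ↑) * diagWinding h ε) ∎

  ⊕-flipAt-square : ∀ {n} (a : Tuple k n) ε i j → i ≢ j → ∀ l →
    (a ⊕ ε ⊕ flipAt i (flipAt j ε)) l ≡ (a ⊕ flipAt i ε ⊕ flipAt j ε) l
  ⊕-flipAt-square a ε i j i≢j l with l ≟ᶠ i | l ≟ᶠ j
  ... | yes refl | yes refl = ⊥-elim (i≢j refl)
  ... | yes refl | no l≢j = begin
    step (flipAt l (flipAt j ε) l) (step (ε l) (a l))
      ≡⟨ cong (λ s → step s (step (ε l) (a l)))
              (trans (flipAt-same l (flipAt j ε)) (cong opp (flipAt-other j ε l l≢j))) ⟩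
    step (opp (ε l)) (step (ε l) (a l))
      ≡⟨ trans (step-opp (ε l) (a l)) (sym (opp-step (ε l) (a l))) ⟩
    step (ε l) (step (opp (ε l)) (a l))
      ≡⟨ cong₂ (λ s t → step s (step t (a l))) (flipAt-other j ε l l≢j) (flipAt-same l ε) ⟨
    step (flipAt j ε l) (step (flipAt l ε l) (a l)) ∎
  ... | no l≢i | _ = cong₂ (λ s t → step s (step t (a l)))
                           (flipAt-other i (flipAt j ε) l l≢i) (sym (flipAt-other i ε l l≢i))

  module _ {n} (h : Tuple k n → Fin 3) (pol : IsPol k n h) (ext : Extensional h) where

    diagWinding-extensional : Extensional (diagWinding h)
    diagWinding-extensional e = sum-cong (allTuples k n) (λ a →
      cong (wind (h a)) (ext (λ j → cong (λ s → step s (a j)) (e j))))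

    wind-translate-square : ∀ a α β γ δ → (∀ l → (a ⊕ α ⊕ β) l ≡ (a ⊕ γ ⊕ δ) l) →
      wind (h a) (h (a ⊕ α)) + wind (h (a ⊕ α)) (h (a ⊕ α ⊕ β))
        ≡ wind (h a) (h (a ⊕ γ)) + wind (h (a ⊕ γ)) (h (a ⊕ γ ⊕ δ))
    wind-translate-square a α β γ δ same-end = begin
      wind (h a) (h (a ⊕ α)) + wind (h (a ⊕ α)) (h (a ⊕ α ⊕ β))
        ≡⟨ wind-square _ _ _ _ (pol _ _ (adjPow-⊕ a α)) (pol _ _ (adjPow-⊕ (a ⊕ α) β))
                               (pol _ _ (adjPow-⊕ a γ))
                               (subst (Adj 3 (h (a ⊕ γ))) (ext (sym ∘ same-end)) (pol _ _ (adjPow-⊕ (a ⊕ γ) δ))) ⟩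
      wind (h a) (h (a ⊕ γ)) + wind (h (a ⊕ γ)) (h (a ⊕ α ⊕ β))
        ≡⟨ cong (λ c → wind (h a) (h (a ⊕ γ)) + wind (h (a ⊕ γ)) c) (ext same-end) ⟩
      wind (h a) (h (a ⊕ γ)) + wind (h (a ⊕ γ)) (h (a ⊕ γ ⊕ δ)) ∎

    diagWinding-square : SquareProperty (diagWinding h)
    diagWinding-square ε i j i≢j = begin
      diagWinding h ε + diagWinding h εᵢⱼ
        ≡⟨ cong (_+_ (diagWinding h ε))
                (sum-translate n ε (λ a → wind (h a) (h (a ⊕ εᵢⱼ))) (translate-ext εᵢⱼ)) ⟨
      diagWinding h ε + ∑[ a ∈ allTuples k n ] wind (h (a ⊕ ε)) (h (a ⊕ ε ⊕ εᵢⱼ))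
        ≡⟨ sum-distrib-+ (allTuples k n) _ _ ⟨
      ∑[ a ∈ allTuples k n ] (wind (h a) (h (a ⊕ ε)) + wind (h (a ⊕ ε)) (h (a ⊕ ε ⊕ εᵢⱼ)))
        ≡⟨ sum-cong (allTuples k n) (λ a → wind-translate-square a ε εᵢⱼ εᵢ εⱼ (same-end a)) ⟩
      ∑[ a ∈ allTuples k n ] (wind (h a) (h (a ⊕ εᵢ)) + wind (h (a ⊕ εᵢ)) (h (a ⊕ εᵢ ⊕ εⱼ)))
        ≡⟨ sum-distrib-+ (allTuples k n) _ _ ⟩
      diagWinding h εᵢ + ∑[ a ∈ allTuples k n ] wind (h (a ⊕ εᵢ)) (h (a ⊕ εᵢ ⊕ εⱼ))
        ≡⟨ cong (_+_ (diagWinding h εᵢ))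
                (sum-translate n εᵢ (λ a → wind (h a) (h (a ⊕ εⱼ))) (translate-ext εⱼ)) ⟩
      diagWinding h εᵢ + diagWinding h εⱼ ∎
      where
      εᵢⱼ εᵢ εⱼ : Tuple 2 n
      εᵢⱼ = flipAt i (flipAt j ε)
      εᵢ  = flipAt i ε
      εⱼ  = flipAt j ε
      translate-ext : ∀ ζ → Extensional (λ a → wind (h a) (h (a ⊕ ζ)))
      translate-ext ζ e = cong₂ wind (ext e) (ext (λ l → cong (step (ζ l)) (e l)))
      same-end : ∀ a l → (a ⊕ ε ⊕ εᵢⱼ) l ≡ (a ⊕ εᵢ ⊕ εⱼ) l
      same-end a = ⊕-flipAt-square a ε i j i≢j

    diagWinding-antisym : diagWinding h all↓ + diagWinding h all↑ ≡ 0ℤ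
    diagWinding-antisym = begin
      diagWinding h all↓ + diagWinding h all↑
        ≡⟨ cong (_+ diagWinding h all↑) (sum-translate n all↑ (λ a → wind (h a) (h (a ⊕ all↓))) translate-ext) ⟨
      ∑[ a ∈ allTuples k n ] wind (h (a ⊕ all↑)) (h (a ⊕ all↑ ⊕ all↓)) + diagWinding h all↑
        ≡⟨ cong (_+ diagWinding h all↑) (sum-cong (allTuples k n) (λ a →
             trans (cong (wind (h (a ⊕ all↑))) (ext (λ l → down-up (a l)))) (wind-antisym (h a) (h (a ⊕ all↑))))) ⟩
      ∑[ a ∈ allTuples k n ] (- wind (h a) (h (a ⊕ all↑))) + diagWinding h all↑
        ≡⟨ cong (_+ diagWinding h all↑) (sum-neg (allTuples k n) _) ⟩
      - diagWinding h all↑ + diagWinding h all↑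
        ≡⟨ ℤP.+-inverseˡ (diagWinding h all↑) ⟩
      0ℤ ∎
      where translate-ext : Extensional (λ a → wind (h a) (h (a ⊕ all↓)))
            translate-ext e = cong₂ wind (ext e) (ext (λ l → cong down (e l)))

  edgeWinding-slope : ∀ m (h : Tuple k (suc m) → Fin 3) → IsPol k (suc m) h → Extensional h → ∀ i →
    + 2 * edgeWinding i h ≡ + (2 ℕ.^ m) * slope (diagWinding h) i
  edgeWinding-slope m h pol ext i = begin
    + 2 * edgeWinding i h
      ≡⟨ cong (+ 2 *_) (edgeWinding-diagWinding (suc m) i h ext) ⟩
    + 2 * ∑[ ε ∈ signs ] (χ (ε i ≟ᶠ ↑) * Φ ε)
      ≡⟨ sum-*ˡ signs (+ 2) _ ⟨
    ∑[ ε ∈ signs ] (+ 2 * (χ (ε i ≟ᶠ ↑) * Φ ε))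
      ≡⟨ sum-cong signs (λ ε → trans (swap (+ 2) (χ (ε i ≟ᶠ ↑)) (Φ ε))
           (cong (χ (ε i ≟ᶠ ↑) *_) (square⇒linear (suc m) Φ (diagWinding-extensional h pol ext)
              (diagWinding-square h pol ext) (diagWinding-antisym h pol ext) ε))) ⟩
    ∑[ ε ∈ signs ] (χ (ε i ≟ᶠ ↑) * ∑[ l ∈ allFinL (suc m) ] (sign (ε l) * slope Φ l))
      ≡⟨ sum-χ↑-linear m i (slope Φ) ⟩
    + (2 ℕ.^ m) * slope Φ i ∎
    where
    Φ : Tuple 2 (suc m) → ℤ
    Φ = diagWinding h
    signs : List (Tuple 2 (suc m))
    signs = allTuples 2 (suc m)
    swap : ∀ a b c → a * (b * c) ≡ b * (a * c)
    swap = solve-∀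

  module Paths (n : ℕ) (i : Fin (suc n)) where

    private
      V : Set
      V = Tuple k (suc n)
      vertices : List V
      vertices = allTuples k (suc n)
      N : ℤ
      N = + (2 ℕ.^ n)

    edgeSum : (V → V → ℤ) → ℤ
    edgeSum F = ∑[ x ∈ vertices ] ∑[ y ∈ vertices ] (χ (succ? i x y) * F x y)

    pathSum : (V → V → V → ℤ) → ℤ
    pathSum G = ∑[ y ∈ vertices ] ∑[ x ∈ vertices ] ∑[ z ∈ vertices ] (χ (succ? i x y) * χ (succ? i y z) * G x y z)

    pathSum-cong : ∀ {G G′} → (∀ x y z → AdjPow k (suc n) x y → AdjPow k (suc n) y z → G x y z ≡ G′ x y z) →
                   pathSum G ≡ pathSum G′
    pathSum-cong {G} {G′} G≗G′ =
      sum-cong vertices λ y → sum-cong vertices λ x → sum-cong vertices λ z → begin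
        χ (succ? i x y) * χ (succ? i y z) * G x y z         ≡⟨ cong (_* G x y z) (χ-× (succ? i x y) (succ? i y z)) ⟨
        χ (succ? i x y ×-dec succ? i y z) * G x y z         ≡⟨ χ-*-cong (succ? i x y ×-dec succ? i y z)
                                                                 (λ ((xy , _) , (yz , _)) → G≗G′ x y z xy yz) ⟩
        χ (succ? i x y ×-dec succ? i y z) * G′ x y z        ≡⟨ cong (_* G′ x y z) (χ-× (succ? i x y) (succ? i y z)) ⟩
        χ (succ? i x y) * χ (succ? i y z) * G′ x y z        ∎

    pathSum-+ : ∀ G G′ → pathSum (λ x y z → G x y z + G′ x y z) ≡ pathSum G + pathSum G′
    pathSum-+ G G′ = begin
      pathSum (λ x y z → G x y z + G′ x y z)
        ≡⟨ sum-cong vertices (λ y → sum-cong vertices (λ x → trans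
             (sum-cong vertices (λ z → ℤP.*-distribˡ-+ (χ (succ? i x y) * χ (succ? i y z)) (G x y z) (G′ x y z)))
             (sum-distrib-+ vertices _ _))) ⟩
      ∑[ y ∈ vertices ] ∑[ x ∈ vertices ] (∑[ z ∈ vertices ] (χ (succ? i x y) * χ (succ? i y z) * G x y z)
                                         + ∑[ z ∈ vertices ] (χ (succ? i x y) * χ (succ? i y z) * G′ x y z))
        ≡⟨ sum-cong vertices (λ y → sum-distrib-+ vertices _ _) ⟩
      ∑[ y ∈ vertices ] (∑[ x ∈ vertices ] ∑[ z ∈ vertices ] (χ (succ? i x y) * χ (succ? i y z) * G x y z)
                       + ∑[ x ∈ vertices ] ∑[ z ∈ vertices ] (χ (succ? i x y) * χ (succ? i y z) * G′ x y z))
        ≡⟨ sum-distrib-+ vertices _ _ ⟩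
      pathSum G + pathSum G′ ∎

    pathSum-first : ∀ F → pathSum (λ x y z → F x y) ≡ N * edgeSum F
    pathSum-first F = begin
      pathSum (λ x y z → F x y)
        ≡⟨ sum-cong vertices (λ y → sum-cong vertices (λ x → begin
             ∑[ z ∈ vertices ] (χ (succ? i x y) * χ (succ? i y z) * F x y)
               ≡⟨ sum-cong vertices (λ z → reorder (χ (succ? i x y)) (χ (succ? i y z)) (F x y)) ⟩
             ∑[ z ∈ vertices ] (χ (succ? i x y) * F x y * χ (succ? i y z))
               ≡⟨ sum-*ˡ vertices (χ (succ? i x y) * F x y) _ ⟩
             χ (succ? i x y) * F x y * ∑[ z ∈ vertices ] χ (succ? i y z)
               ≡⟨ cong (χ (succ? i x y) * F x y *_) (out-degree n i y) ⟩
             χ (succ? i x y) * F x y * N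
               ≡⟨ ℤP.*-comm _ N ⟩
             N * (χ (succ? i x y) * F x y) ∎)) ⟩
      ∑[ y ∈ vertices ] ∑[ x ∈ vertices ] (N * (χ (succ? i x y) * F x y))
        ≡⟨ sum-cong vertices (λ y → sum-*ˡ vertices N _) ⟩
      ∑[ y ∈ vertices ] (N * ∑[ x ∈ vertices ] (χ (succ? i x y) * F x y))
        ≡⟨ sum-*ˡ vertices N _ ⟩
      N * ∑[ y ∈ vertices ] ∑[ x ∈ vertices ] (χ (succ? i x y) * F x y)
        ≡⟨ cong (N *_) (sum-comm vertices vertices _) ⟩
      N * edgeSum F ∎
      where reorder : ∀ a b c → a * b * c ≡ a * c * b
            reorder = solve-∀

    pathSum-second : ∀ F → pathSum (λ x y z → F y z) ≡ N * edgeSum F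
    pathSum-second F = begin
      pathSum (λ x y z → F y z)
        ≡⟨ sum-cong vertices (λ y → sum-comm vertices vertices _) ⟩
      ∑[ y ∈ vertices ] ∑[ z ∈ vertices ] ∑[ x ∈ vertices ] (χ (succ? i x y) * χ (succ? i y z) * F y z)
        ≡⟨ sum-cong vertices (λ y → sum-cong vertices (λ z → begin
             ∑[ x ∈ vertices ] (χ (succ? i x y) * χ (succ? i y z) * F y z)
               ≡⟨ sum-cong vertices (λ x → reorder (χ (succ? i x y)) (χ (succ? i y z)) (F y z)) ⟩
             ∑[ x ∈ vertices ] (χ (succ? i y z) * F y z * χ (succ? i x y))
               ≡⟨ sum-*ˡ vertices (χ (succ? i y z) * F y z) _ ⟩
             χ (succ? i y z) * F y z * ∑[ x ∈ vertices ] χ (succ? i x y)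
               ≡⟨ cong (χ (succ? i y z) * F y z *_) (in-degree n i y) ⟩
             χ (succ? i y z) * F y z * N
               ≡⟨ ℤP.*-comm _ N ⟩
             N * (χ (succ? i y z) * F y z) ∎)) ⟩
      ∑[ y ∈ vertices ] ∑[ z ∈ vertices ] (N * (χ (succ? i y z) * F y z))
        ≡⟨ sum-cong vertices (λ y → sum-*ˡ vertices N _) ⟩
      ∑[ y ∈ vertices ] (N * ∑[ z ∈ vertices ] (χ (succ? i y z) * F y z))
        ≡⟨ sum-*ˡ vertices N _ ⟩
      N * edgeSum F ∎
      where reorder : ∀ a b c → a * b * c ≡ b * c * a
            reorder = solve-∀

  Compatible : ∀ {n} → (Tuple k n → Fin 3) → (Tuple k n → Fin 3) → Set
  Compatible {n} p q = ∀ x y → AdjPow k n x y → Adj 3 (p x) (q y)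

  module _ n (i : Fin (suc n)) where

    open Paths n i

    private
      N : ℤ
      N = + (2 ℕ.^ n)

    -- Along every 2-path x → y → z, the colours p x, p y, p z and p x, q y, p z form a square.
    pathSum-compatible : ∀ p q → IsPol k (suc n) p → Compatible p q → Compatible q p →
      N * edgeWinding i p + N * edgeWinding i p
        ≡ N * edgeSum (λ x y → wind (p x) (q y)) + N * edgeSum (λ x y → wind (q x) (p y))
    pathSum-compatible p q pol pq qp = begin
      N * edgeWinding i p + N * edgeWinding i p
        ≡⟨ cong₂ _+_ (pathSum-first (λ x y → wind (p x) (p y))) (pathSum-second (λ y z → wind (p y) (p z))) ⟨
      pathSum (λ x y z → wind (p x) (p y)) + pathSum (λ x y z → wind (p y) (p z))
        ≡⟨ pathSum-+ _ _ ⟨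
      pathSum (λ x y z → wind (p x) (p y) + wind (p y) (p z))
        ≡⟨ pathSum-cong (λ x y z xy yz → wind-square _ _ _ _ (pol x y xy) (pol y z yz) (pq x y xy) (qp y z yz)) ⟩
      pathSum (λ x y z → wind (p x) (q y) + wind (q y) (p z))
        ≡⟨ pathSum-+ _ _ ⟩
      pathSum (λ x y z → wind (p x) (q y)) + pathSum (λ x y z → wind (q y) (p z))
        ≡⟨ cong₂ _+_ (pathSum-first (λ x y → wind (p x) (q y))) (pathSum-second (λ y z → wind (q y) (p z))) ⟩
      N * edgeSum (λ x y → wind (p x) (q y)) + N * edgeSum (λ x y → wind (q x) (p y)) ∎

    edgeWinding-compatible : ∀ p q → IsPol k (suc n) p → IsPol k (suc n) q → Compatible p q → Compatible q p →
                             edgeWinding i p ≡ edgeWinding i q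
    edgeWinding-compatible p q pol-p pol-q pq qp =
      ℤP.*-cancelˡ-≡ N _ _ {{ℕP.m^n≢0 2 n}} (ℤP.*-cancelˡ-≡ (+ 2) _ _ (begin
        + 2 * (N * edgeWinding i p)               ≡⟨ double (N * edgeWinding i p) ⟩
        N * edgeWinding i p + N * edgeWinding i p ≡⟨ pathSum-compatible p q pol-p pq qp ⟩
        N * Wpq + N * Wqp                         ≡⟨ ℤP.+-comm (N * Wpq) (N * Wqp) ⟩
        N * Wqp + N * Wpq                         ≡⟨ pathSum-compatible q p pol-q qp pq ⟨
        N * edgeWinding i q + N * edgeWinding i q ≡⟨ double (N * edgeWinding i q) ⟨
        + 2 * (N * edgeWinding i q)               ∎))
      where
      Wpq Wqp : ℤ
      Wpq = edgeSum (λ x y → wind (p x) (q y))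
      Wqp = edgeSum (λ x y → wind (q x) (p y))
      double : ∀ a → + 2 * a ≡ a + a
      double = solve-∀

  pol-≐ : ∀ {n} {h : Tuple k n → Fin 3} → IsPol k n h → ∀ {a a′ b b′} →
          (∀ j → a j ≡ a′ j) → (∀ j → b j ≡ b′ j) → AdjPow k n a b → Adj 3 (h a′) (h b′)
  pol-≐ pol a≐a′ b≐b′ adj = pol _ _ (λ j → subst₂ (Adj k) (a≐a′ j) (b≐b′ j) (adj j))

  module _ {n} (h : Tuple k n → Fin 3) (pol : IsPol k n h) where

    canon-pol : IsPol k n (h ∘ canon)
    canon-pol a b = pol-≐ pol (sym ∘ canon-pointwise a) (sym ∘ canon-pointwise b)

    canon-compatible : Compatible h (h ∘ canon)
    canon-compatible a b = pol-≐ pol (λ _ → refl) (sym ∘ canon-pointwise b)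

    compatible-canon : Compatible (h ∘ canon) h
    compatible-canon a b = pol-≐ pol (sym ∘ canon-pointwise a) (λ _ → refl)

  canon-extensional : ∀ {n} (h : Tuple k n → Fin 3) → Extensional (h ∘ canon)
  canon-extensional h = cong h ∘ canon-cong

  +[2k]^m : ∀ m → + ((2 ℕ.* k) ℕ.^ m) ≡ + (2 ℕ.^ m) * + (k ℕ.^ m)
  +[2k]^m m = trans (cong +_ (^-distribʳ-* 2 k m)) (ℤP.pos-* (2 ℕ.^ m) (k ℕ.^ m))
    where
    ^-distribʳ-* : ∀ a b e → (a ℕ.* b) ℕ.^ e ≡ a ℕ.^ e ℕ.* b ℕ.^ e
    ^-distribʳ-* a b zero    = refl
    ^-distribʳ-* a b (suc e) = trans (cong (a ℕ.* b ℕ.*_) (^-distribʳ-* a b e)) (interchange a b _ _)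
      where interchange : ∀ a b x y → a ℕ.* b ℕ.* (x ℕ.* y) ≡ a ℕ.* x ℕ.* (b ℕ.* y)
            interchange = ℕ-Solver.solve-∀

  slope-degree : ∀ m (i : Fin (suc m)) (f h : Tuple k (suc m) → Fin 3) →
    IsPol k (suc m) f → IsPol k (suc m) h → Extensional h → Compatible f h → Compatible h f →
    ∀ d → IsDeg k (suc m) f i d → slope (diagWinding h) i ≡ + 6 * (+ (k ℕ.^ m) * d)
  slope-degree m i f h pol-f pol-h ext fh hf d deg = ℤP.*-cancelˡ-≡ 2^m _ _ {{ℕP.m^n≢0 2 m}} (begin
    2^m * slope (diagWinding h) i                ≡⟨ edgeWinding-slope m h pol-h ext i ⟨
    + 2 * edgeWinding i h                        ≡⟨ cong (+ 2 *_) (edgeWinding-compatible m i f h pol-f pol-h fh hf) ⟨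
    + 2 * edgeWinding i f                        ≡⟨ cong (+ 2 *_) (degree⇒edgeWinding (suc m) i f d deg) ⟩
    + 2 * (+ 3 * (+ ((2 ℕ.* k) ℕ.^ m) * d))      ≡⟨ cong (λ z → + 2 * (+ 3 * (z * d))) (+[2k]^m m) ⟩
    + 2 * (+ 3 * (2^m * + (k ℕ.^ m) * d))        ≡⟨ regroup 2^m (+ (k ℕ.^ m)) d ⟩
    2^m * (+ 6 * (+ (k ℕ.^ m) * d))              ∎)
    where
    2^m : ℤ
    2^m = + (2 ℕ.^ m)
    regroup : ∀ p q d → + 2 * (+ 3 * (p * q * d)) ≡ p * (+ 6 * (q * d))
    regroup = solve-∀

module Minors (K : ℕ) (2≤K : 2 ℕ.≤ K) (t : ℕ) (K≡2t : K ≡ 2 ℕ.* t) where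

  open Polymorphisms K 2≤K public

  -- Since k is odd, two steps generate all of ℤ/k.
  shift2-invariant⇒constant : (g : Fin k → ℤ) → (∀ z → g (shift 2 z) ≡ g z) → ∀ y z → g y ≡ g z
  shift2-invariant⇒constant g g-shift2 y z = trans (g≡g0 y) (sym (g≡g0 z))
    where
    g-even : ∀ r x → g (shift (2 ℕ.* r) x) ≡ g x
    g-even zero    x = cong g (shift-0 x)
    g-even (suc r) x = begin
      g (shift (2 ℕ.* suc r) x)          ≡⟨ cong (λ q → g (shift q x))
                                                 (trans (ℕP.*-suc 2 r) (ℕP.+-comm 2 (2 ℕ.* r))) ⟩
      g (shift (2 ℕ.* r ℕ.+ 2) x)        ≡⟨ cong g (shift-shift 2 (2 ℕ.* r) x) ⟨
      g (shift 2 (shift (2 ℕ.* r) x))    ≡⟨ g-shift2 _ ⟩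
      g (shift (2 ℕ.* r) x)              ≡⟨ g-even r x ⟩
      g x                                ∎
    g-up : ∀ x → g (up x) ≡ g x
    g-up x = begin
      g (up x)                     ≡⟨ cong g (shift-k (up x)) ⟨
      g (shift k (shift 1 x))      ≡⟨ cong g (shift-shift k 1 x) ⟩
      g (shift (suc k) x)          ≡⟨ cong (λ q → g (shift (suc (suc q)) x)) K≡2t ⟩
      g (shift (2 ℕ.+ 2 ℕ.* t) x)  ≡⟨ cong (λ q → g (shift q x)) (ℕP.*-suc 2 t) ⟨
      g (shift (2 ℕ.* suc t) x)    ≡⟨ g-even (suc t) x ⟩
      g x                          ∎
    g-shift : ∀ r → g (shift r zero) ≡ g zero
    g-shift zero    = cong g (shift-0 zero)
    g-shift (suc r) = begin
      g (shift (suc r) zero)       ≡⟨ cong (λ q → g (shift q zero)) (ℕP.+-comm 1 r) ⟩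
      g (shift (r ℕ.+ 1) zero)     ≡⟨ cong g (shift-shift 1 r zero) ⟨
      g (up (shift r zero))        ≡⟨ g-up _ ⟩
      g (shift r zero)             ≡⟨ g-shift r ⟩
      g zero                       ∎
    g≡g0 : ∀ y → g y ≡ g zero
    g≡g0 y = trans (cong g (sym (shift-toℕ y))) (g-shift (toℕ y))

  module _ {m n} (h : Tuple k m → Fin 3) (pol : IsPol k m h) (ext : Extensional h)
           (π : Fin m → Fin n) (η : Tuple 2 n) where

    private
      ε : Tuple 2 m
      ε l = η (π l)

      T : Tuple k n → Tuple k m → Tuple k m
      T x u l = shift (toℕ (x (π l))) (u l)

      -- Ψ (const zero) is the diagonal winding of minor h π along η, while the sum of Ψ over
      -- all u is kⁿ times the diagonal winding of h along ε.
      Ψ : Tuple k m → ℤ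
      Ψ u = ∑[ x ∈ allTuples k n ] wind (h (T x u)) (h (T x u ⊕ ε))

      Ψ-extensional : Extensional Ψ
      Ψ-extensional e = sum-cong (allTuples k n) (λ x → cong₂ wind
        (ext (λ l → cong (shift (toℕ (x (π l)))) (e l)))
        (ext (λ l → cong (step (ε l) ∘ shift (toℕ (x (π l)))) (e l))))

      Ψ-⊕-invariant : ∀ u δ → Ψ (u ⊕ δ) ≡ Ψ u
      Ψ-⊕-invariant u δ = sym (cancel (Ψ u) (Ψ (u ⊕ δ)) (∑[ x ∈ xs ] E x) (begin
        Ψ u + ∑[ x ∈ xs ] E x
          ≡⟨ sum-distrib-+ xs (λ x → wind (h (Tᵤ x)) (h (Tᵤ x ⊕ ε))) E ⟨
        ∑[ x ∈ xs ] (wind (h (Tᵤ x)) (h (Tᵤ x ⊕ ε)) + E x)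
          ≡⟨ sum-cong xs square ⟩
        ∑[ x ∈ xs ] (D x + wind (h (T x (u ⊕ δ))) (h (T x (u ⊕ δ) ⊕ ε)))
          ≡⟨ sum-distrib-+ xs D _ ⟩
        ∑[ x ∈ xs ] D x + Ψ (u ⊕ δ)
          ≡⟨ cong (_+ Ψ (u ⊕ δ)) E≡D ⟨
        ∑[ x ∈ xs ] E x + Ψ (u ⊕ δ) ∎))
        where
        xs : List (Tuple k n)
        xs = allTuples k n
        Tᵤ : Tuple k n → Tuple k m
        Tᵤ x = T x u
        D E : Tuple k n → ℤ
        D x = wind (h (Tᵤ x)) (h (Tᵤ x ⊕ δ))
        E x = wind (h (Tᵤ x ⊕ ε)) (h (Tᵤ x ⊕ ε ⊕ δ))
        Tᵤ⊕δ : ∀ x l → (Tᵤ x ⊕ δ) l ≡ T x (u ⊕ δ) l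
        Tᵤ⊕δ x l = step-shift (toℕ (x (π l))) (δ l) (u l)
        square : ∀ x → wind (h (Tᵤ x)) (h (Tᵤ x ⊕ ε)) + E x
                       ≡ D x + wind (h (T x (u ⊕ δ))) (h (T x (u ⊕ δ) ⊕ ε))
        square x = trans (wind-translate-square h pol ext (Tᵤ x) ε δ δ ε (λ l → step-comm (δ l) (ε l) (Tᵤ x l)))
                         (cong (_+_ (D x)) (cong₂ wind (ext (Tᵤ⊕δ x)) (ext (λ l → cong (step (ε l)) (Tᵤ⊕δ x l)))))
        Tᵤ⊕ε : ∀ x l → (Tᵤ x ⊕ ε) l ≡ Tᵤ (x ⊕ η) l
        Tᵤ⊕ε x l = sym (shift-toℕ-step (η (π l)) (x (π l)) (u l))
        E≡D : ∑[ x ∈ xs ] E x ≡ ∑[ x ∈ xs ] D x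
        E≡D = trans (sum-cong xs (λ x → cong₂ wind (ext (Tᵤ⊕ε x)) (ext (λ l → cong (step (δ l)) (Tᵤ⊕ε x l)))))
                    (sum-translate n η D (λ e → cong₂ wind
                       (ext (λ l → cong (λ y → shift (toℕ y) (u l)) (e (π l))))
                       (ext (λ l → cong (λ y → step (δ l) (shift (toℕ y) (u l))) (e (π l))))))
        cancel : ∀ a b X → a + X ≡ X + b → a ≡ b
        cancel a b X e = begin
          a             ≡⟨ shuffle a X ⟩
          (a + X) - X   ≡⟨ cong (_- X) e ⟩
          (X + b) - X   ≡⟨ shuffle′ X b ⟩
          b             ∎
          where shuffle : ∀ a X → a ≡ (a + X) - X
                shuffle = solve-∀
                shuffle′ : ∀ X b → (X + b) - X ≡ b
                shuffle′ = solve-∀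

      Ψ-updateAt : ∀ l u z → Ψ (updateAt u l (const z)) ≡ Ψ u
      Ψ-updateAt l u z = trans (shift2-invariant⇒constant g g-shift2 z (u l)) (Ψ-extensional u[l≔ul])
        where
        g : Fin k → ℤ
        g z = Ψ (updateAt u l (const z))
        u[l≔ul] : ∀ j → updateAt u l (const (u l)) j ≡ u j
        u[l≔ul] j with j ≟ᶠ l
        ... | yes refl = updateAt-updates j u
        ... | no j≢l   = updateAt-minimal j l u j≢l
        two-steps : ∀ z j → (updateAt u l (const z) ⊕ all↑ ⊕ flipAt l all↓) j ≡ updateAt u l (const (shift 2 z)) j
        two-steps z j with j ≟ᶠ l
        ... | yes refl = begin
          step (flipAt j all↓ j) (up (updateAt u j (const z) j))
            ≡⟨ cong₂ (λ s y → step s (up y)) (flipAt-same j all↓) (updateAt-updates j u) ⟩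
          up (up z)
            ≡⟨ shift-shift 1 1 z ⟩
          shift 2 z
            ≡⟨ updateAt-updates j u ⟨
          updateAt u j (const (shift 2 z)) j ∎
        ... | no j≢l = begin
          step (flipAt l all↓ j) (up (updateAt u l (const z) j))
            ≡⟨ cong₂ (λ s y → step s (up y)) (flipAt-other l all↓ j j≢l) (updateAt-minimal j l u j≢l) ⟩
          down (up (u j))
            ≡⟨ down-up (u j) ⟩
          u j
            ≡⟨ updateAt-minimal j l u j≢l ⟨
          updateAt u l (const (shift 2 z)) j ∎
        g-shift2 : ∀ z → g (shift 2 z) ≡ g z
        g-shift2 z = begin
          g (shift 2 z)                       ≡⟨ Ψ-extensional (two-steps z) ⟨
          Ψ (u[l≔z] ⊕ all↑ ⊕ flipAt l all↓)   ≡⟨ Ψ-⊕-invariant (u[l≔z] ⊕ all↑) (flipAt l all↓) ⟩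
          Ψ (u[l≔z] ⊕ all↑)                   ≡⟨ Ψ-⊕-invariant u[l≔z] all↑ ⟩
          g z                                 ∎
          where u[l≔z] : Tuple k m
                u[l≔z] = updateAt u l (const z)

      sum-Ψ : ∑[ u ∈ allTuples k m ] Ψ u ≡ + (k ℕ.^ n) * diagWinding h ε
      sum-Ψ = begin
        ∑[ u ∈ allTuples k m ] Ψ u
          ≡⟨ sum-comm (allTuples k m) (allTuples k n) _ ⟩
        ∑[ x ∈ allTuples k n ] ∑[ u ∈ allTuples k m ] wind (h (T x u)) (h (T x u ⊕ ε))
          ≡⟨ sum-cong (allTuples k n) (λ x →
               sum-allTuples-bijection k m (λ l → shift (toℕ (x (π l)))) (λ l → shift (toℕ (x (π l)) ℕ.* K))
                 (λ l → shift-inverseˡ (toℕ (x (π l)))) (λ l → shift-inverseʳ (toℕ (x (π l))))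
                 (λ v → wind (h v) (h (v ⊕ ε))) (λ e → cong₂ wind (ext e) (ext (λ l → cong (step (ε l)) (e l))))) ⟩
        ∑[ x ∈ allTuples k n ] diagWinding h ε
          ≡⟨ sum-allTuples-const k n _ ⟩
        + (k ℕ.^ n) * diagWinding h ε ∎

      Ψ-zero : Ψ (const zero) ≡ diagWinding (minor h π) η
      Ψ-zero = sum-cong (allTuples k n) (λ x → cong₂ wind
        (ext (λ l → shift-toℕ (x (π l))))
        (ext (λ l → cong (step (ε l)) (shift-toℕ (x (π l))))))

    diagWinding-minor : + (k ℕ.^ m) * diagWinding (minor h π) η ≡ + (k ℕ.^ n) * diagWinding h (λ l → η (π l))
    diagWinding-minor = begin
      + (k ℕ.^ m) * diagWinding (minor h π) η   ≡⟨ cong (+ (k ℕ.^ m) *_) Ψ-zero ⟨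
      + (k ℕ.^ m) * Ψ (const zero)              ≡⟨ sum-allTuples-const k m _ ⟨
      ∑[ u ∈ allTuples k m ] Ψ (const zero)     ≡⟨ sum-cong (allTuples k m) (λ u →
                                                     coordinatewise⇒constant m Ψ Ψ-extensional Ψ-updateAt zero u) ⟨
      ∑[ u ∈ allTuples k m ] Ψ u                ≡⟨ sum-Ψ ⟩
      + (k ℕ.^ n) * diagWinding h ε             ∎

  minor-pol : ∀ {m n} {h : Tuple k m → Fin 3} → IsPol k m h → (π : Fin m → Fin n) → IsPol k n (minor h π)
  minor-pol pol π a b adj = pol _ _ (λ l → adj (π l))

  minor-compatible : ∀ {m n} {p q : Tuple k m → Fin 3} → Compatible p q → (π : Fin m → Fin n) →
                     Compatible (minor p π) (minor q π)
  minor-compatible pq π a b adj = pq _ _ (λ l → adj (π l))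

  minor-extensional : ∀ {m n} {h : Tuple k m → Fin 3} → Extensional h → (π : Fin m → Fin n) →
                      Extensional (minor h π)
  minor-extensional ext π e = ext (λ l → e (π l))

  slope-minor : ∀ m n (h : Tuple k (suc m) → Fin 3) → IsPol k (suc m) h → Extensional h →
    (π : Fin (suc m) → Fin (suc n)) → ∀ j →
    + (k ℕ.^ suc m) * slope (diagWinding (minor h π)) j
      ≡ + (k ℕ.^ suc n) * ∑[ l ∈ allFinL (suc m) ] (χ (π l ≟ᶠ j) * slope (diagWinding h) l)
  slope-minor m n h pol ext π j = begin
    kᴹ * (Φg all↑ - Φg (flipAt j all↑))
      ≡⟨ *-distribˡ-- kᴹ (Φg all↑) _ ⟩
    kᴹ * Φg all↑ - kᴹ * Φg (flipAt j all↑)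
      ≡⟨ cong₂ _-_ (diagWinding-minor h pol ext π all↑) (diagWinding-minor h pol ext π (flipAt j all↑)) ⟩
    kᴺ * Φh all↑ - kᴺ * Φh ε
      ≡⟨ *-distribˡ-- kᴺ (Φh all↑) (Φh ε) ⟨
    kᴺ * (Φh all↑ - Φh ε)
      ≡⟨ cong (kᴺ *_) (difference (square⇒affine (suc m) Φh (diagWinding-extensional h pol ext)
                                                  (diagWinding-square h pol ext) ε)) ⟩
    kᴺ * ∑[ l ∈ allFinL (suc m) ] (χ (ε l ≟ᶠ ↓) * slope Φh l)
      ≡⟨ cong (kᴺ *_) (sum-cong (allFinL (suc m)) (λ l → cong (_* slope Φh l) (χ-flipAt-all↑ j (π l)))) ⟩
    kᴺ * ∑[ l ∈ allFinL (suc m) ] (χ (π l ≟ᶠ j) * slope Φh l) ∎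
    where
    kᴹ kᴺ : ℤ
    kᴹ = + (k ℕ.^ suc m)
    kᴺ = + (k ℕ.^ suc n)
    Φg : Tuple 2 (suc n) → ℤ
    Φg = diagWinding (minor h π)
    Φh : Tuple 2 (suc m) → ℤ
    Φh = diagWinding h
    ε : Tuple 2 (suc m)
    ε l = flipAt j all↑ (π l)
    *-distribˡ-- : ∀ c a b → c * (a - b) ≡ c * a - c * b
    *-distribˡ-- = solve-∀
    difference : ∀ {a s b} → a + s ≡ b → b - a ≡ s
    difference {a} {s} refl = cancel a s
      where cancel : ∀ a s → a + s - a ≡ s
            cancel = solve-∀

  degree-minor : ∀ m n (f : Tuple k (suc m) → Fin 3) → IsPol k (suc m) f → (π : Fin (suc m) → Fin (suc n)) →
    (d : Fin (suc m) → ℤ) → (∀ i → IsDeg k (suc m) f i (d i)) →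
    (d′ : Fin (suc n) → ℤ) → (∀ j → IsDeg k (suc n) (minor f π) j (d′ j)) →
    ∀ j → d′ j ≡ ∑[ l ∈ allFinL (suc m) ] (χ (π l ≟ᶠ j) * d l)
  degree-minor m n f pol π d deg d′ deg′ j =
    ℤP.*-cancelˡ-≡ kᵐ⁺¹ _ _ {{ℕP.m^n≢0 k (suc m)}} (ℤP.*-cancelˡ-≡ kⁿ _ _ {{ℕP.m^n≢0 k n}}
      (ℤP.*-cancelˡ-≡ (+ 6) _ _ (begin
        + 6 * (kⁿ * (kᵐ⁺¹ * d′ j))
          ≡⟨ reorder kᵐ⁺¹ kⁿ (d′ j) ⟩
        kᵐ⁺¹ * (+ 6 * (kⁿ * d′ j))
          ≡⟨ cong (kᵐ⁺¹ *_) slope-ĝ ⟨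
        kᵐ⁺¹ * slope (diagWinding ĝ) j
          ≡⟨ slope-minor m n f̂ (canon-pol f pol) (canon-extensional f) π j ⟩
        kⁿ⁺¹ * ∑[ l ∈ allFinL (suc m) ] (χ (π l ≟ᶠ j) * slope (diagWinding f̂) l)
          ≡⟨ cong (kⁿ⁺¹ *_) (sum-cong (allFinL (suc m)) (λ l → cong (χ (π l ≟ᶠ j) *_) (slope-f̂ l))) ⟩
        kⁿ⁺¹ * ∑[ l ∈ allFinL (suc m) ] (χ (π l ≟ᶠ j) * (+ 6 * (kᵐ * d l)))
          ≡⟨ cong (kⁿ⁺¹ *_) (trans (sum-cong (allFinL (suc m)) (λ l → pull (χ (π l ≟ᶠ j)) kᵐ (d l)))
                                  (sum-*ˡ (allFinL (suc m)) (+ 6 * kᵐ) _)) ⟩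
        kⁿ⁺¹ * (+ 6 * kᵐ * S)
          ≡⟨ cong (_* (+ 6 * kᵐ * S)) (ℤP.pos-* k (k ℕ.^ n)) ⟩
        + k * kⁿ * (+ 6 * kᵐ * S)
          ≡⟨ exchange (+ k) kⁿ kᵐ S ⟩
        + 6 * (kⁿ * (+ k * kᵐ * S))
          ≡⟨ cong (λ z → + 6 * (kⁿ * (z * S))) (ℤP.pos-* k (k ℕ.^ m)) ⟨
        + 6 * (kⁿ * (kᵐ⁺¹ * S)) ∎)))
    where
    f̂ : Tuple k (suc m) → Fin 3
    f̂ = f ∘ canon
    ĝ : Tuple k (suc n) → Fin 3
    ĝ = minor f̂ π
    kᵐ kⁿ kᵐ⁺¹ kⁿ⁺¹ S : ℤ
    kᵐ = + (k ℕ.^ m)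
    kⁿ = + (k ℕ.^ n)
    kᵐ⁺¹ = + (k ℕ.^ suc m)
    kⁿ⁺¹ = + (k ℕ.^ suc n)
    S = ∑[ l ∈ allFinL (suc m) ] (χ (π l ≟ᶠ j) * d l)
    slope-f̂ : ∀ l → slope (diagWinding f̂) l ≡ + 6 * (kᵐ * d l)
    slope-f̂ l = slope-degree m l f f̂ pol (canon-pol f pol) (canon-extensional f)
                             (canon-compatible f pol) (compatible-canon f pol) (d l) (deg l)
    slope-ĝ : slope (diagWinding ĝ) j ≡ + 6 * (kⁿ * d′ j)
    slope-ĝ = slope-degree n j (minor f π) ĝ (minor-pol pol π) (minor-pol (canon-pol f pol) π)
                           (minor-extensional (canon-extensional f) π) (minor-compatible (canon-compatible f pol) π)
                           (minor-compatible (compatible-canon f pol) π) (d′ j) (deg′ j)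
    reorder : ∀ a b x → + 6 * (b * (a * x)) ≡ a * (+ 6 * (b * x))
    reorder = solve-∀
    pull : ∀ c a x → c * (+ 6 * (a * x)) ≡ + 6 * a * (c * x)
    pull = solve-∀
    exchange : ∀ a b c x → a * b * (+ 6 * c * x) ≡ + 6 * (b * (a * c * x))
    exchange = solve-∀

lemma5p7 : (k : ℕ) → 3 ≤ k → Odd k →
    (m n : ℕ) (f : Tuple k m → Fin 3) → IsPol k m f →
    (π : Fin m → Fin n) →
    (d : Fin m → ℤ) → (∀ i → IsDeg k m f i (d i)) →
    (d' : Fin n → ℤ) → (∀ j → IsDeg k n (minor f π) j (d' j)) →
    (x : Fin n → ℤ) → linear d' x ≡ minor (linear d) π x
lemma5p7 k _ _ zero n f pol π d deg d' deg' x = ⊥-elim (C₃-irreflexive _ (pol a a (λ ())))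
  where a : Tuple k zero
        a ()
lemma5p7 k _ _ (suc m) zero f pol π d deg d' deg' x with () ← π zero
lemma5p7 (suc (suc (suc K′))) (s≤s (s≤s (s≤s _))) (t , k≡1+2t) (suc m) (suc n) f pol π d deg d' deg' x =
  trans (linear-cong (degree-minor m n f pol π d deg d' deg') x) (linear-fibres π d x)
  where open Minors (suc (suc K′)) (s≤s (s≤s z≤n)) t (ℕP.suc-injective k≡1+2t)
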